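{- Let $\mathbb{F}$ be a finite field with $n=|\mathbb{F}|$ elements and $R=M_2(\mathbb{F})$. Then for each nontrivial idempotent $A$ of $R$, $d_{G_{Id}(R)}(A)=2n^2-1$ and $d'_{G_{Id}(R)}(A)=\frac{1}{2}(n^2+3n-2)$.
   Context: For a ring $R$, $G_{Id}(R)$ is the simple graph whose vertices are the nontrivial idempotents of $R$ (idempotents other than $0$ and $1$), with distinct $h,k$ adjacent iff $hk=0$ or $kh=0$. For a connected graph $G$ and vertex $v$, $d_G(v)=\sum_{u\in V(G)} d(u,v)$ is the sum of distances from $v$ to all vertices, and $d'_G(v)=\sum_{u\in V(G),u\neq v} \frac{1}{d(u,v)}$ is the sum of reciprocals of distances from $v$ to all other vertices. -}

module Defs where

open import Level using (Level; _⊔_)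
open import Algebra.Bundles using (CommutativeRing)
open import Data.Nat as ℕ using (ℕ; zero; suc; _≤_)
open import Data.Fin as Fin using (Fin)
open import Data.List using (List; map; foldr; allFin)
import Data.List
open import Data.Product using (_×_; _,_; Σ-syntax; ∃-syntax)
open import Data.Sum using (_⊎_)
open import Data.Rational as ℚ using (ℚ; 0ℚ)
open import Data.Integer using (+_)
open import Relation.Nullary using (¬_; Dec; yes; no)
open import Relation.Nullary.Decidable using (_×-dec_; ¬?)
open import Relation.Binary using (Setoid)
open import Relation.Binary.PropositionalEquality as ≡ using (_≡_)
open import Function.Bundles using (Inverse)

record Field (c ℓ : Level) : Set (Level.suc (c ⊔ ℓ)) where
  field
    commRing : CommutativeRing c ℓ
  open CommutativeRing commRing public
  field
    0≉1     : ¬ (0# ≈ 1#)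
    inverse : ∀ x → ¬ (x ≈ 0#) → ∃[ y ] (x * y ≈ 1#)

HasCard : ∀ {c ℓ} → Field c ℓ → ℕ → Set (c ⊔ ℓ)
HasCard F n = Inverse (≡.setoid (Fin n)) (Field.setoid F)

sumℕ : ∀ {a} {A : Set a} → List A → (A → ℕ) → ℕ
sumℕ xs f = foldr (λ x acc → f x ℕ.+ acc) 0 xs

sumℚ : ∀ {a} {A : Set a} → List A → (A → ℚ) → ℚ
sumℚ xs f = foldr (λ x acc → f x ℚ.+ acc) 0ℚ xs

-- 1/k as a rational (with the irrelevant convention 1/0 = 0; only used for k ≥ 1).
recip : ℕ → ℚ
recip zero    = 0ℚ
recip (suc k) = (+ 1) ℚ./ suc k

module M2 {c ℓ} (F : Field c ℓ) where
  open Field F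

  -- 2×2 matrices [[a , b] , [c , d]] as 4-tuples (a , b , c , d).
  Mat : Set c
  Mat = Carrier × Carrier × Carrier × Carrier

  _≈M_ : Mat → Mat → Set ℓ
  (a , b , c' , d) ≈M (a' , b' , c'' , d') = a ≈ a' × b ≈ b' × c' ≈ c'' × d ≈ d'

  _·_ : Mat → Mat → Mat
  (a , b , c' , d) · (e , f , g , h) =
    (a * e + b * g , a * f + b * h , c' * e + d * g , c' * f + d * h)

  O I : Mat
  O = (0# , 0# , 0# , 0#)
  I = (1# , 0# , 0# , 1#)

  NontrivIdem : Mat → Set ℓ
  NontrivIdem A = (A · A) ≈M A × ¬ (A ≈M O) × ¬ (A ≈M I)

  Adj : Mat → Mat → Set ℓ
  Adj h k = NontrivIdem h × NontrivIdem k × ¬ (h ≈M k) × ((h · k) ≈M O ⊎ (k · h) ≈M O)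

  data Walk : Mat → Mat → ℕ → Set (c ⊔ ℓ) where
    here : ∀ {u v} → NontrivIdem u → u ≈M v → Walk u v 0
    step : ∀ {u w v k} → Adj u w → Walk w v k → Walk u v (suc k)

  IsDist : Mat → Mat → ℕ → Set (c ⊔ ℓ)
  IsDist u v k = Walk u v k × (∀ m → Walk u v m → k ≤ m)

  module Enum {n : ℕ} (card : HasCard F n) where
    open Inverse card using (to; from; to-cong; from-cong; inverseˡ)

    _≟F_ : (x y : Carrier) → Dec (x ≈ y)
    x ≟F y with from x Fin.≟ from y
    ... | yes p = yes (trans (sym (inverseˡ ≡.refl)) (trans (≡.subst (λ z → to (from x) ≈ to z) p refl) (inverseˡ ≡.refl)))
    ... | no ¬p = no (λ x≈y → ¬p (from-cong x≈y))

    _≟M_ : (A B : Mat) → Dec (A ≈M B)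
    (a , b , c' , d) ≟M (a' , b' , c'' , d') =
      (a ≟F a') ×-dec ((b ≟F b') ×-dec ((c' ≟F c'') ×-dec (d ≟F d')))

    isNontrivIdem? : (A : Mat) → Dec (NontrivIdem A)
    isNontrivIdem? A = ((A · A) ≟M A) ×-dec (¬? (A ≟M O) ×-dec ¬? (A ≟M I))

    allMat : List Mat
    allMat = Data.List.concatMap (λ i → Data.List.concatMap (λ j → Data.List.concatMap (λ k →
               map (λ l → (to i , to j , to k , to l)) (allFin n)) (allFin n)) (allFin n)) (allFin n)

    -- d_G(A) = Σ_{u ∈ V(G)} d(u , A)
    distSum : (Mat → ℕ) → ℕ
    distSum d = sumℕ allMat (λ u → selℕ (isNontrivIdem? u) (d u))
      where selℕ : ∀ {p} {P : Set p} → Dec P → ℕ → ℕ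
            selℕ (yes _) k = k
            selℕ (no _)  _ = 0

    -- d'_G(A) = Σ_{u ∈ V(G), u ≠ A} 1 / d(u , A)
    recipSum : Mat → (Mat → ℕ) → ℚ
    recipSum A d = sumℚ allMat (λ u → sel (isNontrivIdem? u ×-dec ¬? (u ≟M A)) (recip (d u)))
      where sel : ∀ {p} {P : Set p} → Dec P → ℚ → ℚ
            sel (yes _) q = q
            sel (no _)  _ = 0ℚ

{-# OPTIONS --safe #-}

-- Over a field the nontrivial idempotents of M₂(F) are exactly the matrices
-- (a, b; c, d) with trace 1 and determinant 0; counting the solutions of
-- b c = a (1 - a) gives n² + n of them.  Each is similar to E = (1, 0; 0, 0),
-- and conjugation is an automorphism of G_Id, so every vertex has the degree
-- of E, whose neighbours are the (0, y; 0, 1) and the (0, 0; z, 1): 2n - 1 in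
-- all.  A vertex u ≠ A that is not a neighbour of A has a common neighbour
-- with it (for A = E and u = (x, y; z, w) one has x ≠ 0 and can take
-- (0, 0; -z/x, 1)).  So the distances from A are one 0, 2n - 1 ones and
-- n² - n twos: d(A) = 2n² - 1 and d'(A) = 2n - 1 + (n² - n)/2.

module Submission where

open import Defs
open import Algebra.Bundles using (CommutativeRing)
open import Data.Nat using (ℕ)

-- The standard library instantiates its ring solver with ℕ coefficients
-- only, which cannot express subtraction; here it is instantiated with ℤ.
module CommutativeRingSolver {c ℓ} (R : CommutativeRing c ℓ) where
  open import Data.Nat as ℕ using (zero; suc)
  import Data.Nat.Properties as ℕ
  open import Data.Integer as ℤ using (ℤ; +_; -[1+_]; _⊖_)
  import Data.Integer.Properties as ℤ
  open import Data.Maybe using (Maybe; just; nothing)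
  open import Relation.Nullary using (yes; no)
  open import Relation.Binary.PropositionalEquality as ≡ using (_≡_)

  open CommutativeRing R
  open import Algebra.Properties.Ring ring using (-‿involutive; -‿+-comm; -0#≈0#; -‿distribˡ-*; -‿distribʳ-*)
  open import Algebra.Properties.Semiring.Mult.TCOptimised semiring using (_×_; 1+×; ×-homo-+; ×1-homo-*)
  open import Algebra.Solver.Ring.AlmostCommutativeRing using (fromCommutativeRing; _-Raw-AlmostCommutative⟶_)
  open import Relation.Binary.Reasoning.Setoid setoid

  -- The optimised _×_ has 1 × x = x, so that con (+ 1) denotes exactly 1#.
  ⟦_⟧ℤ : ℤ → Carrier
  ⟦ + k ⟧ℤ = k × 1#
  ⟦ -[1+ k ] ⟧ℤ = - (suc k × 1#)

  private
    sub-shift : ∀ x y → x - y ≈ (1# + x) - (1# + y)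
    sub-shift x y = begin
      x - y                  ≈⟨ +-identityˡ _ ⟨
      0# + (x - y)           ≈⟨ +-congʳ (-‿inverseʳ 1#) ⟨
      (1# - 1#) + (x - y)    ≈⟨ +-assoc 1# (- 1#) (x - y) ⟩
      1# + (- 1# + (x - y))  ≈⟨ +-congˡ (+-assoc (- 1#) x (- y)) ⟨
      1# + ((- 1# + x) - y)  ≈⟨ +-congˡ (+-congʳ (+-comm (- 1#) x)) ⟩
      1# + ((x - 1#) - y)    ≈⟨ +-congˡ (+-assoc x (- 1#) (- y)) ⟩
      1# + (x + (- 1# - y))  ≈⟨ +-assoc 1# x (- 1# - y) ⟨
      (1# + x) + (- 1# - y)  ≈⟨ +-congˡ (-‿+-comm 1# y) ⟩
      (1# + x) - (1# + y)    ∎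

  ⊖-homo : ∀ m k → ⟦ m ⊖ k ⟧ℤ ≈ m × 1# - k × 1#
  ⊖-homo m zero = begin
    ⟦ m ⊖ 0 ⟧ℤ         ≡⟨ ≡.cong ⟦_⟧ℤ (ℤ.⊖-≥ {m} ℕ.z≤n) ⟩
    m × 1#             ≈⟨ +-identityʳ _ ⟨
    m × 1# + 0#        ≈⟨ +-congˡ -0#≈0# ⟨
    m × 1# - 0#        ∎
  ⊖-homo zero (suc k) = begin
    ⟦ 0 ⊖ suc k ⟧ℤ     ≡⟨ ≡.cong ⟦_⟧ℤ (ℤ.⊖-< {0} {suc k} (ℕ.s≤s ℕ.z≤n)) ⟩
    - (suc k × 1#)     ≈⟨ +-identityˡ _ ⟨
    0# - suc k × 1#    ∎
  ⊖-homo (suc m) (suc k) = begin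
    ⟦ suc m ⊖ suc k ⟧ℤ                ≡⟨ ≡.cong ⟦_⟧ℤ (ℤ.[1+m]⊖[1+n]≡m⊖n m k) ⟩
    ⟦ m ⊖ k ⟧ℤ                         ≈⟨ ⊖-homo m k ⟩
    m × 1# - k × 1#                    ≈⟨ sub-shift _ _ ⟩
    (1# + m × 1#) - (1# + k × 1#)      ≈⟨ +-cong (1+× m 1#) (-‿cong (1+× k 1#)) ⟨
    suc m × 1# - suc k × 1#            ∎

  +-homo : ∀ i j → ⟦ i ℤ.+ j ⟧ℤ ≈ ⟦ i ⟧ℤ + ⟦ j ⟧ℤ
  +-homo (+ m) (+ k) = ×-homo-+ 1# m k
  +-homo (+ m) -[1+ k ] = ⊖-homo m (suc k)
  +-homo -[1+ m ] (+ k) = trans (⊖-homo k (suc m)) (+-comm _ _)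
  +-homo -[1+ m ] -[1+ k ] = begin
    - (suc (suc (m ℕ.+ k)) × 1#)        ≡⟨ ≡.cong (λ t → - (t × 1#)) (ℕ.+-suc (suc m) k) ⟨
    - ((suc m ℕ.+ suc k) × 1#)          ≈⟨ -‿cong (×-homo-+ 1# (suc m) (suc k)) ⟩
    - (suc m × 1# + suc k × 1#)         ≈⟨ -‿+-comm _ _ ⟨
    - (suc m × 1#) - suc k × 1#         ∎

  -‿homo : ∀ i → ⟦ ℤ.- i ⟧ℤ ≈ - ⟦ i ⟧ℤ
  -‿homo (+ zero) = sym -0#≈0#
  -‿homo (+ suc k) = refl
  -‿homo -[1+ k ] = sym (-‿involutive _)

  private
    *-homo-negʳ : ∀ i j → ⟦ i ℤ.* j ⟧ℤ ≈ ⟦ i ⟧ℤ * ⟦ j ⟧ℤ → ⟦ i ℤ.* ℤ.- j ⟧ℤ ≈ ⟦ i ⟧ℤ * ⟦ ℤ.- j ⟧ℤ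
    *-homo-negʳ i j h = begin
      ⟦ i ℤ.* ℤ.- j ⟧ℤ        ≡⟨ ≡.cong ⟦_⟧ℤ (ℤ.neg-distribʳ-* i j) ⟨
      ⟦ ℤ.- (i ℤ.* j) ⟧ℤ      ≈⟨ -‿homo (i ℤ.* j) ⟩
      - ⟦ i ℤ.* j ⟧ℤ          ≈⟨ -‿cong h ⟩
      - (⟦ i ⟧ℤ * ⟦ j ⟧ℤ)     ≈⟨ -‿distribʳ-* _ _ ⟩
      ⟦ i ⟧ℤ * - ⟦ j ⟧ℤ       ≈⟨ *-congˡ (-‿homo j) ⟨
      ⟦ i ⟧ℤ * ⟦ ℤ.- j ⟧ℤ     ∎

    *-homo-negˡ : ∀ i j → ⟦ i ℤ.* j ⟧ℤ ≈ ⟦ i ⟧ℤ * ⟦ j ⟧ℤ → ⟦ ℤ.- i ℤ.* j ⟧ℤ ≈ ⟦ ℤ.- i ⟧ℤ * ⟦ j ⟧ℤ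
    *-homo-negˡ i j h = begin
      ⟦ ℤ.- i ℤ.* j ⟧ℤ        ≡⟨ ≡.cong ⟦_⟧ℤ (ℤ.neg-distribˡ-* i j) ⟨
      ⟦ ℤ.- (i ℤ.* j) ⟧ℤ      ≈⟨ -‿homo (i ℤ.* j) ⟩
      - ⟦ i ℤ.* j ⟧ℤ          ≈⟨ -‿cong h ⟩
      - (⟦ i ⟧ℤ * ⟦ j ⟧ℤ)     ≈⟨ -‿distribˡ-* _ _ ⟩
      - ⟦ i ⟧ℤ * ⟦ j ⟧ℤ       ≈⟨ *-congʳ (-‿homo i) ⟨
      ⟦ ℤ.- i ⟧ℤ * ⟦ j ⟧ℤ     ∎

    *-homo-pos : ∀ m j → ⟦ + m ℤ.* j ⟧ℤ ≈ ⟦ + m ⟧ℤ * ⟦ j ⟧ℤ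
    *-homo-pos m (+ k) = trans (reflexive (≡.cong ⟦_⟧ℤ (≡.sym (ℤ.pos-* m k)))) (×1-homo-* m k)
    *-homo-pos m -[1+ k ] = *-homo-negʳ (+ m) (+ suc k) (*-homo-pos m (+ suc k))

  *-homo : ∀ i j → ⟦ i ℤ.* j ⟧ℤ ≈ ⟦ i ⟧ℤ * ⟦ j ⟧ℤ
  *-homo (+ m) j = *-homo-pos m j
  *-homo -[1+ m ] j = *-homo-negˡ (+ suc m) j (*-homo-pos (suc m) j)

  private
    ℤ⟶R : ℤ.+-*-rawRing -Raw-AlmostCommutative⟶ fromCommutativeRing R
    ℤ⟶R = record
      { ⟦_⟧ = ⟦_⟧ℤ ; +-homo = +-homo ; *-homo = *-homo ; -‿homo = -‿homo
      ; 0-homo = refl ; 1-homo = refl }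

    ⟦⟧ℤ-≟ : ∀ i j → Maybe (⟦ i ⟧ℤ ≈ ⟦ j ⟧ℤ)
    ⟦⟧ℤ-≟ i j with i ℤ.≟ j
    ... | yes ≡.refl = just refl
    ... | no _ = nothing

  open import Algebra.Solver.Ring ℤ.+-*-rawRing (fromCommutativeRing R) ℤ⟶R ⟦⟧ℤ-≟ public
    using (solve; _:=_; _:+_; _:*_; :-_; _:-_; con)

module FiniteSums where
  open import Data.Nat as ℕ using (zero; suc; _+_; _*_)
  open import Data.Nat.Properties using (+-assoc; +-identityʳ; *-zeroʳ; *-comm; *-distribˡ-+; +-commutativeSemigroup)
  open import Algebra.Properties.CommutativeSemigroup +-commutativeSemigroup using () renaming (interchange to +-interchange)
  open import Data.Fin as Fin using (Fin)
  open import Data.Fin.Properties using (suc-injective)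
  open import Data.List using (List; []; _∷_; _++_; map; concatMap; allFin; length)
  open import Data.List.Properties using (map-tabulate)
  import Data.Integer as ℤ
  import Data.Integer.Properties as ℤ
  open import Data.Integer.Tactic.RingSolver as ℤ-Solver using ()
  open import Data.Rational as ℚ using (ℚ; _/_)
  import Data.Rational.Properties as ℚ
  import Data.Rational.Unnormalised as ℚᵘ
  import Data.Rational.Unnormalised.Properties as ℚᵘ
  open import Data.Empty using (⊥-elim)
  open import Relation.Nullary using (¬_; Dec; yes; no)
  open import Relation.Nullary.Decidable using (_×-dec_; _⊎-dec_)
  open import Relation.Binary.PropositionalEquality as ≡ using (_≡_; refl; sym; trans; cong; cong₂)
  open import Function using (_∘_; id; _⇔_; mk⇔; Equivalence)

  when : ∀ {p} {P : Set p} → Dec P → ℕ → ℕ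
  when (yes _) k = k
  when (no _)  _ = 0

  module _ {p} {P : Set p} where

    when-yes : P → (P? : Dec P) → ∀ k → when P? k ≡ k
    when-yes _ (yes _) k = refl
    when-yes x (no ¬x) k = ⊥-elim (¬x x)

    when-no : ¬ P → (P? : Dec P) → ∀ k → when P? k ≡ 0
    when-no ¬x (yes x) k = ⊥-elim (¬x x)
    when-no _  (no _)  k = refl

    when-* : (P? : Dec P) → ∀ k → when P? k ≡ when P? 1 * k
    when-* (yes _) k = sym (+-identityʳ k)
    when-* (no _)  k = refl

  module _ {p q} {P : Set p} {Q : Set q} where

    when-⇔ : P ⇔ Q → (P? : Dec P) (Q? : Dec Q) → ∀ k → when P? k ≡ when Q? k
    when-⇔ P⇔Q (yes _)  (yes _)  k = refl
    when-⇔ P⇔Q (yes p)  (no ¬q)  k = ⊥-elim (¬q (Equivalence.to P⇔Q p))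
    when-⇔ P⇔Q (no ¬p)  (yes q)  k = ⊥-elim (¬p (Equivalence.from P⇔Q q))
    when-⇔ P⇔Q (no _)   (no _)   k = refl

    when-× : (P? : Dec P) (Q? : Dec Q) → ∀ k → when (P? ×-dec Q?) k ≡ when P? (when Q? k)
    when-× (yes _) (yes _) k = refl
    when-× (yes _) (no _)  k = refl
    when-× (no _)  _       k = refl

    when-comm : (P? : Dec P) (Q? : Dec Q) → ∀ k → when P? (when Q? k) ≡ when Q? (when P? k)
    when-comm (yes _) (yes _) k = refl
    when-comm (yes _) (no _)  k = refl
    when-comm (no _)  (yes _) k = refl
    when-comm (no _)  (no _)  k = refl

    when-⊎-× : (P? : Dec P) (Q? : Dec Q) → when (P? ⊎-dec Q?) 1 + when (P? ×-dec Q?) 1 ≡ when P? 1 + when Q? 1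
    when-⊎-× (yes _) (yes _) = refl
    when-⊎-× (yes _) (no _)  = refl
    when-⊎-× (no _)  (yes _) = refl
    when-⊎-× (no _)  (no _)  = refl

  module _ {a} {A : Set a} where

    sumℕ-cong : ∀ (xs : List A) {f g : A → ℕ} → (∀ x → f x ≡ g x) → sumℕ xs f ≡ sumℕ xs g
    sumℕ-cong []       f≗g = refl
    sumℕ-cong (x ∷ xs) f≗g = cong₂ _+_ (f≗g x) (sumℕ-cong xs f≗g)

    sumℕ-+ : ∀ (xs : List A) (f g : A → ℕ) → sumℕ xs (λ x → f x + g x) ≡ sumℕ xs f + sumℕ xs g
    sumℕ-+ []       f g = refl
    sumℕ-+ (x ∷ xs) f g =
      trans (cong (f x + g x +_) (sumℕ-+ xs f g)) (+-interchange (f x) (g x) (sumℕ xs f) (sumℕ xs g))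

    sumℕ-*ˡ : ∀ (xs : List A) k (f : A → ℕ) → sumℕ xs (λ x → k * f x) ≡ k * sumℕ xs f
    sumℕ-*ˡ []       k f = sym (*-zeroʳ k)
    sumℕ-*ˡ (x ∷ xs) k f = trans (cong (k * f x +_) (sumℕ-*ˡ xs k f)) (sym (*-distribˡ-+ k (f x) _))

    sumℕ-*ʳ : ∀ (xs : List A) k (f : A → ℕ) → sumℕ xs (λ x → f x * k) ≡ sumℕ xs f * k
    sumℕ-*ʳ xs k f = trans (sumℕ-cong xs (λ x → *-comm (f x) k)) (trans (sumℕ-*ˡ xs k f) (*-comm k _))

    sumℕ-const : ∀ (xs : List A) k → sumℕ xs (λ _ → k) ≡ length xs * k
    sumℕ-const []       k = refl
    sumℕ-const (x ∷ xs) k = cong (k +_) (sumℕ-const xs k)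

    sumℕ-++ : ∀ (xs ys : List A) (f : A → ℕ) → sumℕ (xs ++ ys) f ≡ sumℕ xs f + sumℕ ys f
    sumℕ-++ []       ys f = refl
    sumℕ-++ (x ∷ xs) ys f = trans (cong (f x +_) (sumℕ-++ xs ys f)) (sym (+-assoc (f x) _ _))

  module _ {a b} {A : Set a} {B : Set b} where

    sumℕ-map : ∀ (xs : List A) (h : A → B) (f : B → ℕ) → sumℕ (map h xs) f ≡ sumℕ xs (f ∘ h)
    sumℕ-map []       h f = refl
    sumℕ-map (x ∷ xs) h f = cong (f (h x) +_) (sumℕ-map xs h f)

    sumℕ-concatMap : ∀ (xs : List A) (g : A → List B) (f : B → ℕ) →
                     sumℕ (concatMap g xs) f ≡ sumℕ xs (λ x → sumℕ (g x) f)
    sumℕ-concatMap []       g f = refl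
    sumℕ-concatMap (x ∷ xs) g f =
      trans (sumℕ-++ (g x) (concatMap g xs) f) (cong (sumℕ (g x) f +_) (sumℕ-concatMap xs g f))

    sumℕ-swap : ∀ (xs : List A) (ys : List B) (h : A → B → ℕ) →
                sumℕ xs (λ x → sumℕ ys (h x)) ≡ sumℕ ys (λ y → sumℕ xs (λ x → h x y))
    sumℕ-swap []       ys h = sym (trans (sumℕ-const ys 0) (*-zeroʳ (length ys)))
    sumℕ-swap (x ∷ xs) ys h = trans (cong (sumℕ ys (h x) +_) (sumℕ-swap xs ys h)) (sym (sumℕ-+ ys (h x) _))

  sumℕ-allFin-suc : ∀ n (f : Fin (suc n) → ℕ) → sumℕ (allFin (suc n)) f ≡ f Fin.zero + sumℕ (allFin n) (f ∘ Fin.suc)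
  sumℕ-allFin-suc n f =
    cong (f Fin.zero +_) (trans (cong (λ xs → sumℕ xs f) (sym (map-tabulate id Fin.suc))) (sumℕ-map (allFin n) Fin.suc f))

  sumℕ-allFin-point : ∀ n (j : Fin n) → sumℕ (allFin n) (λ i → when (i Fin.≟ j) 1) ≡ 1
  sumℕ-allFin-point (suc n) j = trans (sumℕ-allFin-suc n _) (split j)
    where
    split : ∀ j → when (Fin.zero Fin.≟ j) 1 + sumℕ (allFin n) (λ i → when (Fin.suc i Fin.≟ j) 1) ≡ 1
    split Fin.zero     = cong suc (trans (sumℕ-const (allFin n) 0) (*-zeroʳ (length (allFin n))))
    split (Fin.suc j′) = trans
      (sumℕ-cong (allFin n) (λ i → when-⇔ (mk⇔ suc-injective (cong Fin.suc)) (Fin.suc i Fin.≟ Fin.suc j′) (i Fin.≟ j′) 1))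
      (sumℕ-allFin-point n j′)

  half : ℕ → ℚ
  half k = ℤ.+ k / 2

  half-+ : ∀ a b → half a ℚ.+ half b ≡ half (a ℕ.+ b)
  half-+ a b = ℚ.toℚᵘ-injective (begin
    ℚ.toℚᵘ (half a ℚ.+ half b)               ≈⟨ ℚ.toℚᵘ-homo-+ (half a) (half b) ⟩
    ℚ.toℚᵘ (half a) ℚᵘ.+ ℚ.toℚᵘ (half b)     ≈⟨ ℚᵘ.+-cong (ℚ.toℚᵘ-fromℚᵘ (ℤ.+ a ℚᵘ./ 2)) (ℚ.toℚᵘ-fromℚᵘ (ℤ.+ b ℚᵘ./ 2)) ⟩
    ℤ.+ a ℚᵘ./ 2 ℚᵘ.+ ℤ.+ b ℚᵘ./ 2           ≈⟨ ℚᵘ.*≡* cross-multiplied ⟩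
    ℤ.+ (a ℕ.+ b) ℚᵘ./ 2                     ≈⟨ ℚ.toℚᵘ-fromℚᵘ (ℤ.+ (a ℕ.+ b) ℚᵘ./ 2) ⟨
    ℚ.toℚᵘ (half (a ℕ.+ b))                  ∎)
    where
    open ℚᵘ.≃-Reasoning
    cross-multiplied : (ℤ.+ a ℤ.* ℤ.+ 2 ℤ.+ ℤ.+ b ℤ.* ℤ.+ 2) ℤ.* ℤ.+ 2 ≡ ℤ.+ (a ℕ.+ b) ℤ.* ℤ.+ 4
    cross-multiplied = trans (ring (ℤ.+ a) (ℤ.+ b)) (cong (ℤ._* ℤ.+ 4) (sym (ℤ.pos-+ a b)))
      where
      ring : ∀ x y → (x ℤ.* ℤ.+ 2 ℤ.+ y ℤ.* ℤ.+ 2) ℤ.* ℤ.+ 2 ≡ (x ℤ.+ y) ℤ.* ℤ.+ 4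
      ring = ℤ-Solver.solve-∀

  sumℚ-half : ∀ {a} {A : Set a} (xs : List A) (f : A → ℕ) → sumℚ xs (λ x → half (f x)) ≡ half (sumℕ xs f)
  sumℚ-half []       f = refl
  sumℚ-half (x ∷ xs) f = trans (cong (half (f x) ℚ.+_) (sumℚ-half xs f)) (half-+ (f x) (sumℕ xs f))

module FieldProperties {c ℓ} (F : Field c ℓ) where
  open import Data.Integer using (+_)
  open import Data.Product using (_,_)
  open import Data.Sum using (_⊎_; inj₁; inj₂)
  open import Relation.Nullary using (¬_; yes; no)
  open import Relation.Binary using (Decidable)
  open import Function using (_⇔_; mk⇔; Equivalence)
  import Relation.Binary.Reasoning.Setoid as SetoidReasoning
  open Field F
  open CommutativeRingSolver commRing
  open import Algebra.Properties.Ring ring using (x∙y⁻¹≈ε⇒x≈y)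
  open SetoidReasoning setoid

  x≈0⇒x*y≈0 : ∀ {x} y → x ≈ 0# → x * y ≈ 0#
  x≈0⇒x*y≈0 y x≈0 = trans (*-congʳ x≈0) (zeroˡ y)

  y≈0⇒x*y≈0 : ∀ x {y} → y ≈ 0# → x * y ≈ 0#
  y≈0⇒x*y≈0 x y≈0 = trans (*-congˡ y≈0) (zeroʳ x)

  x*y≈k⇔y≈x⁻¹*k : ∀ {x x⁻¹ y k} → x * x⁻¹ ≈ 1# → (x * y ≈ k ⇔ y ≈ x⁻¹ * k)
  x*y≈k⇔y≈x⁻¹*k {x} {x⁻¹} {y} {k} xx⁻¹≈1 = mk⇔
    (λ xy≈k → begin
      y               ≈⟨ *-identityˡ y ⟨
      1# * y          ≈⟨ *-congʳ xx⁻¹≈1 ⟨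
      (x * x⁻¹) * y   ≈⟨ solve 3 (λ x x⁻¹ y → (x :* x⁻¹) :* y := x⁻¹ :* (x :* y)) refl x x⁻¹ y ⟩
      x⁻¹ * (x * y)   ≈⟨ *-congˡ xy≈k ⟩
      x⁻¹ * k         ∎)
    (λ y≈x⁻¹k → begin
      x * y           ≈⟨ *-congˡ y≈x⁻¹k ⟩
      x * (x⁻¹ * k)   ≈⟨ *-assoc x x⁻¹ k ⟨
      (x * x⁻¹) * k   ≈⟨ *-congʳ xx⁻¹≈1 ⟩
      1# * k          ≈⟨ *-identityˡ k ⟩
      k               ∎)

  x≉0⇒x*y≈0⇒y≈0 : ∀ {x y} → ¬ x ≈ 0# → x * y ≈ 0# → y ≈ 0#
  x≉0⇒x*y≈0⇒y≈0 {x} x≉0 xy≈0 =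
    let x⁻¹ , xx⁻¹≈1 = inverse x x≉0
    in trans (Equivalence.to (x*y≈k⇔y≈x⁻¹*k xx⁻¹≈1) xy≈0) (zeroʳ x⁻¹)

  module _ (_≟_ : Decidable _≈_) where

    idempotent⇒0∨1 : ∀ {x} → x * x ≈ x → x ≈ 0# ⊎ x ≈ 1#
    idempotent⇒0∨1 {x} xx≈x with x ≟ 0#
    ... | yes x≈0 = inj₁ x≈0
    ... | no x≉0  = inj₂ (x∙y⁻¹≈ε⇒x≈y x 1# (x≉0⇒x*y≈0⇒y≈0 x≉0 (begin
      x * (x - 1#)  ≈⟨ solve 1 (λ x → x :* (x :- con (+ 1)) := x :* x :- x) refl x ⟩
      x * x - x     ≈⟨ +-congʳ xx≈x ⟩
      x - x         ≈⟨ -‿inverseʳ x ⟩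
      0#            ∎)))

    x[1-x]≈0⇔x≈0⊎x≈1 : ∀ {x} → x * (1# - x) ≈ 0# ⇔ (x ≈ 0# ⊎ x ≈ 1#)
    x[1-x]≈0⇔x≈0⊎x≈1 {x} = mk⇔
      (λ x[1-x]≈0 → idempotent⇒0∨1 (begin
        x * x                ≈⟨ solve 1 (λ x → x :* x := x :- x :* (con (+ 1) :- x)) refl x ⟩
        x - x * (1# - x)     ≈⟨ +-congˡ (-‿cong x[1-x]≈0) ⟩
        x - 0#               ≈⟨ solve 1 (λ x → x :- con (+ 0) := x) refl x ⟩
        x                    ∎))
      λ { (inj₁ x≈0) → x≈0⇒x*y≈0 (1# - x) x≈0
        ; (inj₂ x≈1) → y≈0⇒x*y≈0 x (trans (+-congˡ (-‿cong x≈1)) (-‿inverseʳ 1#)) }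

module Matrices {c ℓ} (F : Field c ℓ) where
  open import Level using (_⊔_)
  open import Data.Nat using (zero; suc; _≤_; z≤n; s≤s)
  open import Data.Integer using (+_)
  open import Data.Product using (_×_; _,_; proj₁; proj₂; Σ-syntax)
  open import Data.Sum using (_⊎_; inj₁; inj₂)
  open import Data.Empty using (⊥; ⊥-elim)
  open import Relation.Nullary using (¬_; yes; no)
  open import Relation.Binary using (Setoid; Decidable)
  open import Function using (_⇔_; mk⇔; Equivalence; Inverse)
  import Relation.Binary.Reasoning.Setoid as SetoidReasoning
  open Field F
  open M2 F
  open CommutativeRingSolver commRing
  open import Algebra.Properties.Ring ring using (x∙y⁻¹≈ε⇒x≈y; x+x≈x⇒x≈0; -0#≈0#)
  open FieldProperties F

  ≈M-refl : ∀ {u} → u ≈M u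
  ≈M-refl = refl , refl , refl , refl

  ≈M-sym : ∀ {u v} → u ≈M v → v ≈M u
  ≈M-sym (e₁ , e₂ , e₃ , e₄) = sym e₁ , sym e₂ , sym e₃ , sym e₄

  ≈M-trans : ∀ {u v w} → u ≈M v → v ≈M w → u ≈M w
  ≈M-trans (e₁ , e₂ , e₃ , e₄) (f₁ , f₂ , f₃ , f₄) = trans e₁ f₁ , trans e₂ f₂ , trans e₃ f₃ , trans e₄ f₄

  ≈M-setoid : Setoid c ℓ
  ≈M-setoid = record
    { Carrier = Mat ; _≈_ = _≈M_
    ; isEquivalence = record { refl = ≈M-refl ; sym = ≈M-sym ; trans = ≈M-trans } }

  module ≈M-Reasoning = SetoidReasoning ≈M-setoid

  ·-cong : ∀ {u u′ v v′} → u ≈M u′ → v ≈M v′ → (u · v) ≈M (u′ · v′)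
  ·-cong (e₁ , e₂ , e₃ , e₄) (f₁ , f₂ , f₃ , f₄) =
    +-cong (*-cong e₁ f₁) (*-cong e₂ f₃) , +-cong (*-cong e₁ f₂) (*-cong e₂ f₄) ,
    +-cong (*-cong e₃ f₁) (*-cong e₄ f₃) , +-cong (*-cong e₃ f₂) (*-cong e₄ f₄)

  ·-congˡ : ∀ {u v v′} → v ≈M v′ → (u · v) ≈M (u · v′)
  ·-congˡ = ·-cong ≈M-refl

  ·-congʳ : ∀ {u u′ v} → u ≈M u′ → (u · v) ≈M (u′ · v)
  ·-congʳ e = ·-cong e ≈M-refl

  ·-assoc : ∀ u v w → ((u · v) · w) ≈M (u · (v · w))
  ·-assoc (a , b , c′ , d) (e , f , g , h) (i , j , k , l) =
    entry a b e f g h i k , entry a b e f g h j l , entry c′ d e f g h i k , entry c′ d e f g h j l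
    where
    entry : ∀ x y e f g h s t →
            (x * e + y * g) * s + (x * f + y * h) * t ≈ x * (e * s + f * t) + y * (g * s + h * t)
    entry = solve 8 (λ x y e f g h s t →
      (x :* e :+ y :* g) :* s :+ (x :* f :+ y :* h) :* t := x :* (e :* s :+ f :* t) :+ y :* (g :* s :+ h :* t))
      refl

  ·-identityˡ : ∀ u → (I · u) ≈M u
  ·-identityˡ (a , b , c′ , d) = entry a c′ , entry b d , entry′ a c′ , entry′ b d
    where
    entry : ∀ x y → 1# * x + 0# * y ≈ x
    entry = solve 2 (λ x y → con (+ 1) :* x :+ con (+ 0) :* y := x) refl
    entry′ : ∀ x y → 0# * x + 1# * y ≈ y
    entry′ = solve 2 (λ x y → con (+ 0) :* x :+ con (+ 1) :* y := y) refl

  ·-identityʳ : ∀ u → (u · I) ≈M u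
  ·-identityʳ (a , b , c′ , d) = entry a b , entry′ a b , entry c′ d , entry′ c′ d
    where
    entry : ∀ x y → x * 1# + y * 0# ≈ x
    entry = solve 2 (λ x y → x :* con (+ 1) :+ y :* con (+ 0) := x) refl
    entry′ : ∀ x y → x * 0# + y * 1# ≈ y
    entry′ = solve 2 (λ x y → x :* con (+ 0) :+ y :* con (+ 1) := y) refl

  ·-zeroˡ : ∀ u → (O · u) ≈M O
  ·-zeroˡ (a , b , c′ , d) = entry a c′ , entry b d , entry a c′ , entry b d
    where
    entry : ∀ x y → 0# * x + 0# * y ≈ 0#
    entry = solve 2 (λ x y → con (+ 0) :* x :+ con (+ 0) :* y := con (+ 0)) refl

  ·-zeroʳ : ∀ u → (u · O) ≈M O
  ·-zeroʳ (a , b , c′ , d) = entry a b , entry a b , entry c′ d , entry c′ d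
    where
    entry : ∀ x y → x * 0# + y * 0# ≈ 0#
    entry = solve 2 (λ x y → x :* con (+ 0) :+ y :* con (+ 0) := con (+ 0)) refl

  ZeroProduct : Mat → Mat → Set ℓ
  ZeroProduct u v = (u · v) ≈M O ⊎ (v · u) ≈M O

  nontrivIdem-resp : ∀ {u v} → u ≈M v → NontrivIdem u → NontrivIdem v
  nontrivIdem-resp u≈v (uu≈u , u≉O , u≉I) =
    ≈M-trans (·-cong (≈M-sym u≈v) (≈M-sym u≈v)) (≈M-trans uu≈u u≈v) ,
    (λ v≈O → u≉O (≈M-trans u≈v v≈O)) , (λ v≈I → u≉I (≈M-trans u≈v v≈I))

  zeroProduct-resp : ∀ {u u′ v v′} → u ≈M u′ → v ≈M v′ → ZeroProduct u v → ZeroProduct u′ v′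
  zeroProduct-resp u≈u′ v≈v′ (inj₁ uv≈O) = inj₁ (≈M-trans (·-cong (≈M-sym u≈u′) (≈M-sym v≈v′)) uv≈O)
  zeroProduct-resp u≈u′ v≈v′ (inj₂ vu≈O) = inj₂ (≈M-trans (·-cong (≈M-sym v≈v′) (≈M-sym u≈u′)) vu≈O)

  nontrivIdem-cong : ∀ {u v} → u ≈M v → NontrivIdem u ⇔ NontrivIdem v
  nontrivIdem-cong u≈v = mk⇔ (nontrivIdem-resp u≈v) (nontrivIdem-resp (≈M-sym u≈v))

  zeroProduct⇒≉ : ∀ {u v} → NontrivIdem v → ZeroProduct u v → ¬ u ≈M v
  zeroProduct⇒≉ (vv≈v , v≉O , _) uv u≈v with zeroProduct-resp u≈v ≈M-refl uv
  ... | inj₁ vv≈O = v≉O (≈M-trans (≈M-sym vv≈v) vv≈O)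
  ... | inj₂ vv≈O = v≉O (≈M-trans (≈M-sym vv≈v) vv≈O)

  zeroProduct⇒adj : ∀ {u v} → NontrivIdem u → NontrivIdem v → ZeroProduct u v → Adj u v
  zeroProduct⇒adj nu nv uv = nu , nv , zeroProduct⇒≉ nv uv , uv

  adj-resp : ∀ {u u′ v v′} → u ≈M u′ → v ≈M v′ → Adj u v → Adj u′ v′
  adj-resp u≈u′ v≈v′ (nu , nv , _ , uv) =
    zeroProduct⇒adj (nontrivIdem-resp u≈u′ nu) (nontrivIdem-resp v≈v′ nv) (zeroProduct-resp u≈u′ v≈v′ uv)

  walk-length-0 : ∀ {u v} → Walk u v 0 → u ≈M v
  walk-length-0 (here _ u≈v) = u≈v

  walk-length-1 : ∀ {u v} → Walk u v 1 → Adj u v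
  walk-length-1 (step uw (here _ w≈v)) = adj-resp ≈M-refl w≈v uw

  isDist-0 : ∀ {u v} → NontrivIdem u → u ≈M v → IsDist u v 0
  isDist-0 nu u≈v = here nu u≈v , λ _ _ → z≤n

  isDist-1 : ∀ {u v} → Adj u v → IsDist u v 1
  isDist-1 {u} {v} uv@(_ , nv , u≉v , _) = step uv (here nv ≈M-refl) , shortest
    where
    shortest : ∀ m → Walk u v m → 1 ≤ m
    shortest zero    walk = ⊥-elim (u≉v (walk-length-0 walk))
    shortest (suc m) _    = s≤s z≤n

  isDist-2 : ∀ {u w v} → Adj u w → Adj w v → ¬ Adj u v → ¬ u ≈M v → IsDist u v 2
  isDist-2 {u} {w} {v} uw wv@(_ , nv , _) ¬uv u≉v = step uw (step wv (here nv ≈M-refl)) , shortest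
    where
    shortest : ∀ m → Walk u v m → 2 ≤ m
    shortest zero          walk = ⊥-elim (u≉v (walk-length-0 walk))
    shortest (suc zero)    walk = ⊥-elim (¬uv (walk-length-1 walk))
    shortest (suc (suc m)) _    = s≤s (s≤s z≤n)

  trace-det⇒nontrivIdem : ∀ {a b c′ d} → a + d ≈ 1# → b * c′ ≈ a * d → NontrivIdem (a , b , c′ , d)
  trace-det⇒nontrivIdem {a} {b} {c′} {d} tr≈1 bc≈ad = (e₁ , e₂ , e₃ , e₄) , ≉O , ≉I
    where
    times-trace : ∀ x → x * (a + d) ≈ x
    times-trace x = trans (*-congˡ tr≈1) (*-identityʳ x)
    e₁ : a * a + b * c′ ≈ a
    e₁ = trans (+-congˡ bc≈ad) (trans (sym (distribˡ a a d)) (times-trace a))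
    e₂ : a * b + b * d ≈ b
    e₂ = trans (solve 3 (λ a b d → a :* b :+ b :* d := b :* (a :+ d)) refl a b d) (times-trace b)
    e₃ : c′ * a + d * c′ ≈ c′
    e₃ = trans (solve 3 (λ a c d → c :* a :+ d :* c := c :* (a :+ d)) refl a c′ d) (times-trace c′)
    e₄ : c′ * b + d * d ≈ d
    e₄ = trans (+-congʳ (trans (*-comm c′ b) bc≈ad))
               (trans (solve 2 (λ a d → a :* d :+ d :* d := d :* (a :+ d)) refl a d) (times-trace d))
    ≉O : ¬ (a , b , c′ , d) ≈M O
    ≉O (a≈0 , _ , _ , d≈0) = 0≉1 (trans (sym (trans (+-cong a≈0 d≈0) (+-identityˡ 0#))) tr≈1)
    ≉I : ¬ (a , b , c′ , d) ≈M I
    ≉I (a≈1 , _ , _ , d≈1) = 0≉1 (sym (x+x≈x⇒x≈0 1# (trans (sym (+-cong a≈1 d≈1)) tr≈1)))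

  module Conjugation {X Y : Mat} (XY≈I : (X · Y) ≈M I) (YX≈I : (Y · X) ≈M I) where
    open ≈M-Reasoning

    conj : Mat → Mat
    conj u = (X · u) · Y

    conj-cong : ∀ {u v} → u ≈M v → conj u ≈M conj v
    conj-cong u≈v = ·-congʳ (·-congˡ u≈v)

    conj-· : ∀ u v → conj (u · v) ≈M (conj u · conj v)
    conj-· u v = begin
      (X · (u · v)) · Y               ≈⟨ ·-congʳ (·-assoc X u v) ⟨
      ((X · u) · v) · Y               ≈⟨ ·-assoc (X · u) v Y ⟩
      (X · u) · (v · Y)               ≈⟨ ·-congˡ (·-congʳ (·-identityˡ v)) ⟨
      (X · u) · ((I · v) · Y)         ≈⟨ ·-congˡ (·-congʳ (·-congʳ YX≈I)) ⟨
      (X · u) · (((Y · X) · v) · Y)   ≈⟨ ·-congˡ (·-congʳ (·-assoc Y X v)) ⟩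
      (X · u) · ((Y · (X · v)) · Y)   ≈⟨ ·-congˡ (·-assoc Y (X · v) Y) ⟩
      (X · u) · (Y · ((X · v) · Y))   ≈⟨ ·-assoc (X · u) Y ((X · v) · Y) ⟨
      ((X · u) · Y) · ((X · v) · Y)   ∎

    conj-O : conj O ≈M O
    conj-O = ≈M-trans (·-congʳ (·-zeroʳ X)) (·-zeroˡ Y)

    conj-I : conj I ≈M I
    conj-I = ≈M-trans (·-congʳ (·-identityʳ X)) XY≈I

    unconj-conj : ∀ u → ((Y · conj u) · X) ≈M u
    unconj-conj u = begin
      (Y · ((X · u) · Y)) · X    ≈⟨ ·-congʳ (·-assoc Y (X · u) Y) ⟨
      ((Y · (X · u)) · Y) · X    ≈⟨ ·-assoc (Y · (X · u)) Y X ⟩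
      (Y · (X · u)) · (Y · X)    ≈⟨ ·-congˡ YX≈I ⟩
      (Y · (X · u)) · I          ≈⟨ ·-identityʳ _ ⟩
      Y · (X · u)                ≈⟨ ·-assoc Y X u ⟨
      (Y · X) · u                ≈⟨ ·-congʳ YX≈I ⟩
      I · u                      ≈⟨ ·-identityˡ u ⟩
      u                          ∎

    conj-injective : ∀ {u v} → conj u ≈M conj v → u ≈M v
    conj-injective {u} {v} e = begin
      u                    ≈⟨ unconj-conj u ⟨
      (Y · conj u) · X     ≈⟨ ·-congʳ (·-congˡ e) ⟩
      (Y · conj v) · X     ≈⟨ unconj-conj v ⟩
      v                    ∎

    conj-nontrivIdem : ∀ {u} → NontrivIdem u → NontrivIdem (conj u)
    conj-nontrivIdem {u} (uu≈u , u≉O , u≉I) =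
      ≈M-trans (≈M-sym (conj-· u u)) (conj-cong uu≈u) ,
      (λ e → u≉O (conj-injective (≈M-trans e (≈M-sym conj-O)))) ,
      (λ e → u≉I (conj-injective (≈M-trans e (≈M-sym conj-I))))

    conj-zeroProduct : ∀ {u v} → ZeroProduct u v → ZeroProduct (conj u) (conj v)
    conj-zeroProduct {u} {v} (inj₁ uv≈O) = inj₁ (≈M-trans (≈M-sym (conj-· u v)) (≈M-trans (conj-cong uv≈O) conj-O))
    conj-zeroProduct {u} {v} (inj₂ vu≈O) = inj₂ (≈M-trans (≈M-sym (conj-· v u)) (≈M-trans (conj-cong vu≈O) conj-O))

    conj-adj : ∀ {u v} → Adj u v → Adj (conj u) (conj v)
    conj-adj (nu , nv , _ , uv) = zeroProduct⇒adj (conj-nontrivIdem nu) (conj-nontrivIdem nv) (conj-zeroProduct uv)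

  det : Mat → Carrier
  det (a , b , c′ , d) = a * d - b * c′

  adjugate : Mat → Mat
  adjugate (a , b , c′ , d) = (d , - b , - c′ , a)

  _⊙_ : Carrier → Mat → Mat
  k ⊙ (a , b , c′ , d) = (k * a , k * b , k * c′ , k * d)

  ·-scaledAdjugate : ∀ δ u → δ * det u ≈ 1# → (u · (δ ⊙ adjugate u)) ≈M I × ((δ ⊙ adjugate u) · u) ≈M I
  ·-scaledAdjugate δ (a , b , c′ , d) δdet≈1 =
    ( trans (solve 5 (λ δ a b c d → a :* (δ :* d) :+ b :* (δ :* (:- c)) := δ :* (a :* d :- b :* c)) refl δ a b c′ d) δdet≈1
    , solve 3 (λ δ a b → a :* (δ :* (:- b)) :+ b :* (δ :* a) := con (+ 0)) refl δ a b
    , solve 3 (λ δ c d → c :* (δ :* d) :+ d :* (δ :* (:- c)) := con (+ 0)) refl δ c′ d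
    , trans (solve 5 (λ δ a b c d → c :* (δ :* (:- b)) :+ d :* (δ :* a) := δ :* (a :* d :- b :* c)) refl δ a b c′ d) δdet≈1 ) ,
    ( trans (solve 5 (λ δ a b c d → (δ :* d) :* a :+ (δ :* (:- b)) :* c := δ :* (a :* d :- b :* c)) refl δ a b c′ d) δdet≈1
    , solve 3 (λ δ b d → (δ :* d) :* b :+ (δ :* (:- b)) :* d := con (+ 0)) refl δ b d
    , solve 3 (λ δ a c → (δ :* (:- c)) :* a :+ (δ :* a) :* c := con (+ 0)) refl δ a c′
    , trans (solve 5 (λ δ a b c d → (δ :* (:- c)) :* b :+ (δ :* a) :* d := δ :* (a :* d :- b :* c)) refl δ a b c′ d) δdet≈1 )

  record Similar (A B : Mat) : Set (c ⊔ ℓ) where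
    field
      X Y   : Mat
      XY≈I  : (X · Y) ≈M I
      YX≈I  : (Y · X) ≈M I
      A≈XBY : A ≈M ((X · B) · Y)

  intertwining⇒similar : ∀ {A B X} δ → δ * det X ≈ 1# → (A · X) ≈M (X · B) → Similar A B
  intertwining⇒similar {A} {B} {X} δ δdet≈1 AX≈XB = record
    { X = X ; Y = Y ; XY≈I = XY≈I ; YX≈I = YX≈I
    ; A≈XBY = begin
        A                ≈⟨ ·-identityʳ A ⟨
        A · I            ≈⟨ ·-congˡ XY≈I ⟨
        A · (X · Y)      ≈⟨ ·-assoc A X Y ⟨
        (A · X) · Y      ≈⟨ ·-congʳ AX≈XB ⟩
        (X · B) · Y      ∎ }
    where
    open ≈M-Reasoning
    Y : Mat
    Y = δ ⊙ adjugate X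
    XY≈I : (X · Y) ≈M I
    XY≈I = proj₁ (·-scaledAdjugate δ X δdet≈1)
    YX≈I : (Y · X) ≈M I
    YX≈I = proj₂ (·-scaledAdjugate δ X δdet≈1)

  similar-respˡ : ∀ {A A′ B} → A ≈M A′ → Similar A′ B → Similar A B
  similar-respˡ A≈A′ s = record { Similar s ; A≈XBY = ≈M-trans A≈A′ (Similar.A≈XBY s) }

  E : Mat
  E = (1# , 0# , 0# , 0#)

  nontrivIdem-E : NontrivIdem E
  nontrivIdem-E = trace-det⇒nontrivIdem (+-identityʳ 1#) (trans (zeroˡ 0#) (sym (zeroʳ 1#)))

  E·u≈O⇔ : ∀ {x y z w} → (E · (x , y , z , w)) ≈M O ⇔ (x ≈ 0# × y ≈ 0#)
  E·u≈O⇔ {x} {y} {z} {w} = mk⇔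
    (λ (e₁ , e₂ , _ , _) → trans (sym (entry x z)) e₁ , trans (sym (entry y w)) e₂)
    (λ (x≈0 , y≈0) → trans (entry x z) x≈0 , trans (entry y w) y≈0 , entry₀ x z , entry₀ y w)
    where
    entry : ∀ s t → 1# * s + 0# * t ≈ s
    entry = solve 2 (λ s t → con (+ 1) :* s :+ con (+ 0) :* t := s) refl
    entry₀ : ∀ s t → 0# * s + 0# * t ≈ 0#
    entry₀ = solve 2 (λ s t → con (+ 0) :* s :+ con (+ 0) :* t := con (+ 0)) refl

  u·E≈O⇔ : ∀ {x y z w} → ((x , y , z , w) · E) ≈M O ⇔ (x ≈ 0# × z ≈ 0#)
  u·E≈O⇔ {x} {y} {z} {w} = mk⇔
    (λ (e₁ , _ , e₃ , _) → trans (sym (entry x y)) e₁ , trans (sym (entry z w)) e₃)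
    (λ (x≈0 , z≈0) → trans (entry x y) x≈0 , entry₀ x y , trans (entry z w) z≈0 , entry₀ z w)
    where
    entry : ∀ s t → s * 1# + t * 0# ≈ s
    entry = solve 2 (λ s t → s :* con (+ 1) :+ t :* con (+ 0) := s) refl
    entry₀ : ∀ s t → s * 0# + t * 0# ≈ 0#
    entry₀ = solve 2 (λ s t → s :* con (+ 0) :+ t :* con (+ 0) := con (+ 0)) refl

  -- The columns of X are a fixed vector of A (a column of A) and a vector
  -- killed by A (a column of I - A), so that A X ≈ X E.
  topLeft≈0⇒similar-E : ∀ {b c′} → b * c′ ≈ 0# → Similar (0# , b , c′ , 1#) E
  topLeft≈0⇒similar-E {b} {c′} bc≈0 = intertwining⇒similar (- 1#) δdet≈1 AX≈XE
    where
    open SetoidReasoning setoid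
    X : Mat
    X = (b , 1# , 1# , - c′)
    δdet≈1 : - 1# * det X ≈ 1#
    δdet≈1 = begin
      - 1# * (b * - c′ - 1# * 1#)   ≈⟨ solve 2 (λ b c → :- con (+ 1) :* (b :* (:- c) :- con (+ 1) :* con (+ 1)) := b :* c :+ con (+ 1)) refl b c′ ⟩
      b * c′ + 1#                   ≈⟨ +-congʳ bc≈0 ⟩
      0# + 1#                       ≈⟨ +-identityˡ 1# ⟩
      1#                            ∎
    AX≈XE : ((0# , b , c′ , 1#) · X) ≈M (X · E)
    AX≈XE =
      solve 1 (λ b → con (+ 0) :* b :+ b :* con (+ 1) := b :* con (+ 1) :+ con (+ 1) :* con (+ 0)) refl b ,
      (begin
        0# * 1# + b * - c′   ≈⟨ solve 2 (λ b c → con (+ 0) :* con (+ 1) :+ b :* (:- c) := :- (b :* c)) refl b c′ ⟩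
        - (b * c′)           ≈⟨ -‿cong bc≈0 ⟩
        - 0#                 ≈⟨ solve 1 (λ b → :- con (+ 0) := b :* con (+ 0) :+ con (+ 1) :* con (+ 0)) refl b ⟩
        b * 0# + 1# * 0#     ∎) ,
      (begin
        c′ * b + 1# * 1#     ≈⟨ +-congʳ (trans (*-comm c′ b) bc≈0) ⟩
        0# + 1# * 1#         ≈⟨ solve 1 (λ c → con (+ 0) :+ con (+ 1) :* con (+ 1) := con (+ 1) :* con (+ 1) :+ (:- c) :* con (+ 0)) refl c′ ⟩
        1# * 1# + - c′ * 0#  ∎) ,
      solve 1 (λ c → c :* con (+ 1) :+ con (+ 1) :* (:- c) := con (+ 1) :* con (+ 0) :+ (:- c) :* con (+ 0)) refl c′

  topLeft-invertible⇒similar-E : ∀ {a a⁻¹ b c′ d} → a * a⁻¹ ≈ 1# → NontrivIdem (a , b , c′ , d) → b * c′ ≈ a * d →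
                                 Similar (a , b , c′ , d) E
  topLeft-invertible⇒similar-E {a} {a⁻¹} {b} {c′} {d} aa⁻¹≈1 ((e₁ , _ , e₃ , _) , _) bc≈ad =
    intertwining⇒similar a⁻¹ δdet≈1 AX≈XE
    where
    open SetoidReasoning setoid
    X : Mat
    X = (a , - b , c′ , a)
    δdet≈1 : a⁻¹ * det X ≈ 1#
    δdet≈1 = begin
      a⁻¹ * (a * a - - b * c′)   ≈⟨ solve 4 (λ a⁻¹ a b c → a⁻¹ :* (a :* a :- (:- b) :* c) := a⁻¹ :* (a :* a :+ b :* c)) refl a⁻¹ a b c′ ⟩
      a⁻¹ * (a * a + b * c′)     ≈⟨ *-congˡ e₁ ⟩
      a⁻¹ * a                    ≈⟨ *-comm a⁻¹ a ⟩
      a * a⁻¹                    ≈⟨ aa⁻¹≈1 ⟩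
      1#                         ∎
    AX≈XE : ((a , b , c′ , d) · X) ≈M (X · E)
    AX≈XE =
      trans e₁ (solve 2 (λ a b → a := a :* con (+ 1) :+ (:- b) :* con (+ 0)) refl a b) ,
      solve 2 (λ a b → a :* (:- b) :+ b :* a := a :* con (+ 0) :+ (:- b) :* con (+ 0)) refl a b ,
      trans e₃ (solve 2 (λ a c → c := c :* con (+ 1) :+ a :* con (+ 0)) refl a c′) ,
      (begin
        c′ * - b + d * a     ≈⟨ solve 4 (λ a b c d → c :* (:- b) :+ d :* a := a :* d :- b :* c) refl a b c′ d ⟩
        a * d - b * c′       ≈⟨ +-congˡ (-‿cong bc≈ad) ⟩
        a * d - a * d        ≈⟨ -‿inverseʳ (a * d) ⟩
        0#                   ≈⟨ solve 2 (λ a c → con (+ 0) := c :* con (+ 0) :+ a :* con (+ 0)) refl a c′ ⟩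
        c′ * 0# + a * 0#     ∎)

  module _ (_≟_ : Decidable _≈_) where
    open SetoidReasoning setoid

    nontrivIdem⇒trace-det : ∀ {a b c′ d} → NontrivIdem (a , b , c′ , d) → a + d ≈ 1# × b * c′ ≈ a * d
    nontrivIdem⇒trace-det {a} {b} {c′} {d} ((e₁ , e₂ , e₃ , e₄) , ≉O , ≉I) with (a + d) ≟ 1#
    ... | yes tr≈1 = tr≈1 , (begin
      b * c′                     ≈⟨ solve 2 (λ a t → t := (a :* a :+ t) :- a :* a) refl a (b * c′) ⟩
      (a * a + b * c′) - a * a   ≈⟨ +-congʳ e₁ ⟩
      a - a * a                  ≈⟨ +-congʳ (trans (*-congˡ tr≈1) (*-identityʳ a)) ⟨
      a * (a + d) - a * a        ≈⟨ solve 2 (λ a d → a :* (a :+ d) :- a :* a := a :* d) refl a d ⟩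
      a * d                      ∎)
    ... | no tr≉1 = ⊥-elim (diagonal-cases (idempotent⇒0∨1 _≟_ aa≈a) (idempotent⇒0∨1 _≟_ dd≈d))
      where
      tr-1≉0 : ¬ (a + d) - 1# ≈ 0#
      tr-1≉0 e = tr≉1 (x∙y⁻¹≈ε⇒x≈y _ _ e)
      b≈0 : b ≈ 0#
      b≈0 = x≉0⇒x*y≈0⇒y≈0 tr-1≉0 (begin
        ((a + d) - 1#) * b    ≈⟨ solve 3 (λ a b d → ((a :+ d) :- con (+ 1)) :* b := (a :* b :+ b :* d) :- b) refl a b d ⟩
        (a * b + b * d) - b   ≈⟨ +-congʳ e₂ ⟩
        b - b                 ≈⟨ -‿inverseʳ b ⟩
        0#                    ∎)
      c≈0 : c′ ≈ 0#
      c≈0 = x≉0⇒x*y≈0⇒y≈0 tr-1≉0 (begin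
        ((a + d) - 1#) * c′    ≈⟨ solve 3 (λ a c d → ((a :+ d) :- con (+ 1)) :* c := (c :* a :+ d :* c) :- c) refl a c′ d ⟩
        (c′ * a + d * c′) - c′ ≈⟨ +-congʳ e₃ ⟩
        c′ - c′                ≈⟨ -‿inverseʳ c′ ⟩
        0#                     ∎)
      aa≈a : a * a ≈ a
      aa≈a = trans (sym (trans (+-congˡ (y≈0⇒x*y≈0 b c≈0)) (+-identityʳ _))) e₁
      dd≈d : d * d ≈ d
      dd≈d = trans (sym (trans (+-congʳ (y≈0⇒x*y≈0 c′ b≈0)) (+-identityˡ _))) e₄
      diagonal-cases : a ≈ 0# ⊎ a ≈ 1# → d ≈ 0# ⊎ d ≈ 1# → ⊥
      diagonal-cases (inj₁ a≈0) (inj₁ d≈0) = ≉O (a≈0 , b≈0 , c≈0 , d≈0)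
      diagonal-cases (inj₂ a≈1) (inj₂ d≈1) = ≉I (a≈1 , b≈0 , c≈0 , d≈1)
      diagonal-cases (inj₁ a≈0) (inj₂ d≈1) = tr≉1 (trans (+-cong a≈0 d≈1) (+-identityˡ 1#))
      diagonal-cases (inj₂ a≈1) (inj₁ d≈0) = tr≉1 (trans (+-cong a≈1 d≈0) (+-identityʳ 1#))

    nontrivIdem⇔ : ∀ {a b c′ d} → NontrivIdem (a , b , c′ , d) ⇔ (d ≈ 1# - a × b * c′ ≈ a * (1# - a))
    nontrivIdem⇔ {a} {b} {c′} {d} = mk⇔
      (λ ni → let tr≈1 , bc≈ad = nontrivIdem⇒trace-det ni
                  d≈1-a = trans (solve 2 (λ a d → d := (a :+ d) :- a) refl a d) (+-congʳ tr≈1)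
              in d≈1-a , trans bc≈ad (*-congˡ d≈1-a))
      (λ (d≈1-a , bc≈a[1-a]) → trace-det⇒nontrivIdem
        (trans (+-congˡ d≈1-a) (solve 1 (λ a → a :+ (con (+ 1) :- a) := con (+ 1)) refl a))
        (trans bc≈a[1-a] (*-congˡ (sym d≈1-a))))

    nontrivIdem-x≈0⇔ : ∀ {x y z w} → x ≈ 0# → NontrivIdem (x , y , z , w) ⇔ (w ≈ 1# × y * z ≈ 0#)
    nontrivIdem-x≈0⇔ {x} {y} {z} {w} x≈0 = mk⇔
      (λ ni → let w≈1-x , yz≈x[1-x] = Equivalence.to nontrivIdem⇔ ni
              in trans w≈1-x 1-x≈1 , trans yz≈x[1-x] x[1-x]≈0)
      (λ (w≈1 , yz≈0) → Equivalence.from nontrivIdem⇔ (trans w≈1 (sym 1-x≈1) , trans yz≈0 (sym x[1-x]≈0)))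
      where
      1-x≈1 : 1# - x ≈ 1#
      1-x≈1 = trans (+-congˡ (trans (-‿cong x≈0) -0#≈0#)) (+-identityʳ 1#)
      x[1-x]≈0 : x * (1# - x) ≈ 0#
      x[1-x]≈0 = x≈0⇒x*y≈0 (1# - x) x≈0

    nontrivIdem⇒similar-E : ∀ {A} → NontrivIdem A → Similar A E
    nontrivIdem⇒similar-E {a , b , c′ , d} ni with nontrivIdem⇒trace-det ni | a ≟ 0#
    ... | tr≈1 , bc≈ad | yes a≈0 = similar-respˡ (a≈0 , refl , refl , d≈1) (topLeft≈0⇒similar-E bc≈0)
      where
      d≈1 : d ≈ 1#
      d≈1 = trans (sym (+-identityˡ d)) (trans (+-congʳ (sym a≈0)) tr≈1)
      bc≈0 : b * c′ ≈ 0#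
      bc≈0 = trans bc≈ad (x≈0⇒x*y≈0 d a≈0)
    ... | _ , bc≈ad | no a≉0 =
      let a⁻¹ , aa⁻¹≈1 = inverse a a≉0 in topLeft-invertible⇒similar-E aa⁻¹≈1 ni bc≈ad

    commonNeighbour-E : ∀ {u} → NontrivIdem u → ¬ ZeroProduct u E → Σ[ C ∈ Mat ] (Adj u C × Adj C E)
    commonNeighbour-E {x , y , z , w} nu ¬uE with nontrivIdem⇒trace-det nu | x ≟ 0#
    ... | _ , yz≈xw | yes x≈0 with y ≟ 0#
    ...   | yes y≈0 = ⊥-elim (¬uE (inj₂ (Equivalence.from E·u≈O⇔ (x≈0 , y≈0))))
    ...   | no y≉0  = ⊥-elim (¬uE (inj₁ (Equivalence.from u·E≈O⇔ (x≈0 , z≈0))))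
      where
      z≈0 : z ≈ 0#
      z≈0 = x≉0⇒x*y≈0⇒y≈0 y≉0 (trans yz≈xw (x≈0⇒x*y≈0 w x≈0))
    commonNeighbour-E {x , y , z , w} nu ¬uE | _ , yz≈xw | no x≉0 with inverse x x≉0
    ... | x⁻¹ , xx⁻¹≈1 =
      C , zeroProduct⇒adj nu nC (inj₂ Cu≈O) , zeroProduct⇒adj nC nontrivIdem-E (inj₂ EC≈O)
      where
      C : Mat
      C = (0# , 0# , - (z * x⁻¹) , 1#)
      nC : NontrivIdem C
      nC = trace-det⇒nontrivIdem (+-identityˡ 1#) (trans (zeroˡ _) (sym (zeroˡ 1#)))
      EC≈O : (E · C) ≈M O
      EC≈O = Equivalence.from E·u≈O⇔ (refl , refl)
      1-xx⁻¹≈0 : 1# - x * x⁻¹ ≈ 0#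
      1-xx⁻¹≈0 = trans (+-congˡ (-‿cong xx⁻¹≈1)) (-‿inverseʳ 1#)
      Cu≈O : (C · (x , y , z , w)) ≈M O
      Cu≈O =
        solve 2 (λ x z → con (+ 0) :* x :+ con (+ 0) :* z := con (+ 0)) refl x z ,
        solve 2 (λ y w → con (+ 0) :* y :+ con (+ 0) :* w := con (+ 0)) refl y w ,
        (begin
          - (z * x⁻¹) * x + 1# * z   ≈⟨ solve 3 (λ x x⁻¹ z → :- (z :* x⁻¹) :* x :+ con (+ 1) :* z := z :* (con (+ 1) :- x :* x⁻¹)) refl x x⁻¹ z ⟩
          z * (1# - x * x⁻¹)         ≈⟨ y≈0⇒x*y≈0 z 1-xx⁻¹≈0 ⟩
          0#                         ∎) ,
        (begin
          - (z * x⁻¹) * y + 1# * w   ≈⟨ solve 4 (λ x⁻¹ y z w → :- (z :* x⁻¹) :* y :+ con (+ 1) :* w := w :- x⁻¹ :* (y :* z)) refl x⁻¹ y z w ⟩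
          w - x⁻¹ * (y * z)          ≈⟨ +-congˡ (-‿cong (*-congˡ yz≈xw)) ⟩
          w - x⁻¹ * (x * w)          ≈⟨ solve 3 (λ x x⁻¹ w → w :- x⁻¹ :* (x :* w) := w :* (con (+ 1) :- x :* x⁻¹)) refl x x⁻¹ w ⟩
          w * (1# - x * x⁻¹)         ≈⟨ y≈0⇒x*y≈0 w 1-xx⁻¹≈0 ⟩
          0#                         ∎)

    module SimilarToE {A} (A∼E : Similar A E) where
      open Similar A∼E
      open Conjugation XY≈I YX≈I public
      private module Back = Conjugation YX≈I XY≈I

      conj-inverse : Inverse ≈M-setoid ≈M-setoid
      conj-inverse = record
        { to = conj ; from = Back.conj ; to-cong = conj-cong ; from-cong = Back.conj-cong
        ; inverse = (λ {x} e → ≈M-trans (conj-cong e) (Back.unconj-conj x))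
                  , (λ {x} e → ≈M-trans (Back.conj-cong e) (unconj-conj x)) }

      conj-nontrivIdem⇔ : ∀ {u} → NontrivIdem (conj u) ⇔ NontrivIdem u
      conj-nontrivIdem⇔ {u} = mk⇔
        (λ n → nontrivIdem-resp (unconj-conj u) (Back.conj-nontrivIdem n))
        conj-nontrivIdem

      zeroProduct-conj⇔ : ∀ {u} → ZeroProduct (conj u) A ⇔ ZeroProduct u E
      zeroProduct-conj⇔ {u} = mk⇔
        (λ z → zeroProduct-resp (unconj-conj u) E≈ (Back.conj-zeroProduct z))
        (λ z → zeroProduct-resp ≈M-refl (≈M-sym A≈XBY) (conj-zeroProduct z))
        where
        E≈ : Back.conj A ≈M E
        E≈ = ≈M-trans (Back.conj-cong A≈XBY) (unconj-conj E)

      commonNeighbour : ∀ {u} → NontrivIdem u → ¬ ZeroProduct u A → Σ[ C ∈ Mat ] (Adj u C × Adj C A)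
      commonNeighbour {u} nu ¬uA =
        let C , u′C , CE = commonNeighbour-E (Back.conj-nontrivIdem nu) ¬u′E
        in conj C , adj-resp (Back.unconj-conj u) ≈M-refl (conj-adj u′C) , adj-resp ≈M-refl (≈M-sym A≈XBY) (conj-adj CE)
        where
        ¬u′E : ¬ ZeroProduct (Back.conj u) E
        ¬u′E z = ¬uA (zeroProduct-resp (Back.unconj-conj u) ≈M-refl (Equivalence.from zeroProduct-conj⇔ z))

module Counting {c ℓ} (F : Field c ℓ) {n : ℕ} (card : HasCard F n) where
  open import Data.Nat using (_+_; _*_; _∸_)
  open import Data.Nat.Properties using (*-identityˡ; *-identityʳ; +-identityʳ; +-assoc; +-cancelʳ-≡; m+n∸n≡m)
  open import Data.Nat.Tactic.RingSolver using (solve-∀)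
  import Data.Fin as Fin
  open import Data.List using (allFin)
  open import Data.List.Properties using (length-tabulate; foldr-cong)
  import Data.Rational as ℚ
  open import Data.Product using (_×_; _,_; proj₁; proj₂)
  open import Data.Sum using (_⊎_; inj₁; inj₂; [_,_]′)
  open import Data.Unit using (⊤; tt)
  open import Data.Empty using (⊥-elim)
  open import Relation.Nullary using (¬_; Dec; yes; no)
  open import Relation.Nullary.Decidable using (_×-dec_; _⊎-dec_)
  open import Relation.Unary using (Pred; Decidable)
  open import Relation.Binary.PropositionalEquality as ≡ using (_≡_)
  open import Function using (_∘_; id; _⇔_; mk⇔; Equivalence; Inverse)
  open FiniteSums
  module F = Field F
  open F using (Carrier; _≈_; 0#; 1#)
  open M2 F
  open Enum card
  open FieldProperties F
  open Matrices F
  private module Card = Inverse card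

  ΣF : (Carrier → ℕ) → ℕ
  ΣF f = sumℕ (allFin n) (f ∘ Card.to)

  ΣM : (Mat → ℕ) → ℕ
  ΣM = sumℕ allMat

  countF : ∀ {p} {P : Pred Carrier p} → Decidable P → ℕ
  countF P? = ΣF (λ x → when (P? x) 1)

  countM : ∀ {p} {P : Pred Mat p} → Decidable P → ℕ
  countM P? = ΣM (λ u → when (P? u) 1)

  ΣF-cong : ∀ {f g : Carrier → ℕ} → (∀ x → f x ≡ g x) → ΣF f ≡ ΣF g
  ΣF-cong f≗g = sumℕ-cong (allFin n) (f≗g ∘ Card.to)

  ΣF-+ : ∀ f g → ΣF (λ x → f x + g x) ≡ ΣF f + ΣF g
  ΣF-+ f g = sumℕ-+ (allFin n) (f ∘ Card.to) (g ∘ Card.to)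

  ΣF-*ˡ : ∀ k f → ΣF (λ x → k * f x) ≡ k * ΣF f
  ΣF-*ˡ k f = sumℕ-*ˡ (allFin n) k (f ∘ Card.to)

  ΣF-*ʳ : ∀ k f → ΣF (λ x → f x * k) ≡ ΣF f * k
  ΣF-*ʳ k f = sumℕ-*ʳ (allFin n) k (f ∘ Card.to)

  ΣF-const : ∀ k → ΣF (λ _ → k) ≡ n * k
  ΣF-const k = ≡.trans (sumℕ-const (allFin n) k) (≡.cong (_* k) (length-tabulate {n = n} id))

  countF-all : countF {P = λ _ → ⊤} (λ _ → yes tt) ≡ n
  countF-all = ≡.trans (ΣF-const 1) (*-identityʳ n)

  countF-≈ : ∀ e → countF (_≟F e) ≡ 1
  countF-≈ e = ≡.trans (sumℕ-cong (allFin n) (λ i → when-⇔ (to≈⇔ i) (Card.to i ≟F e) (i Fin.≟ Card.from e) 1))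
                       (sumℕ-allFin-point n (Card.from e))
    where
    to≈⇔ : ∀ i → Card.to i ≈ e ⇔ i ≡ Card.from e
    to≈⇔ i = mk⇔ (λ e≈ → ≡.sym (Card.inverseʳ (F.sym e≈))) Card.inverseˡ

  ΣF-point : ∀ e k → ΣF (λ x → when (x ≟F e) k) ≡ k
  ΣF-point e k = begin
    ΣF (λ x → when (x ≟F e) k)       ≡⟨ ΣF-cong (λ x → when-* (x ≟F e) k) ⟩
    ΣF (λ x → when (x ≟F e) 1 * k)   ≡⟨ ΣF-*ʳ k (λ x → when (x ≟F e) 1) ⟩
    countF (_≟F e) * k               ≡⟨ ≡.cong (_* k) (countF-≈ e) ⟩
    1 * k                            ≡⟨ *-identityˡ k ⟩
    k                                ∎
    where open ≡.≡-Reasoning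

  ΣM≡ΣF⁴ : ∀ f → ΣM f ≡ ΣF λ x → ΣF λ y → ΣF λ z → ΣF λ w → f (x , y , z , w)
  ΣM≡ΣF⁴ f =
    ≡.trans (sumℕ-concatMap (allFin n) _ f) (sumℕ-cong (allFin n) λ _ →
    ≡.trans (sumℕ-concatMap (allFin n) _ f) (sumℕ-cong (allFin n) λ _ →
    ≡.trans (sumℕ-concatMap (allFin n) _ f) (sumℕ-cong (allFin n) λ _ →
    sumℕ-map (allFin n) _ f)))

  countM-box : ∀ {v p q r s} {V : Pred Mat v} {P : Pred Carrier p} {Q : Pred Carrier q} {R : Pred Carrier r} {S : Pred Carrier s}
               (V? : Decidable V) (P? : Decidable P) (Q? : Decidable Q) (R? : Decidable R) (S? : Decidable S) →
               (∀ {x y z w} → V (x , y , z , w) ⇔ (P x × Q y × R z × S w)) →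
               countM V? ≡ countF P? * (countF Q? * (countF R? * countF S?))
  countM-box V? P? Q? R? S? V⇔ = begin
    countM V?
      ≡⟨ ΣM≡ΣF⁴ _ ⟩
    (ΣF λ x → ΣF λ y → ΣF λ z → ΣF λ w → when (V? (x , y , z , w)) 1)
      ≡⟨ ΣF-cong (λ x → ΣF-cong λ y → ΣF-cong λ z → ΣF-cong λ w → factorise x y z w) ⟩
    (ΣF λ x → ΣF λ y → ΣF λ z → ΣF λ w → [ P? x ] * ([ Q? y ] * ([ R? z ] * [ S? w ])))
      ≡⟨ ΣF-cong (λ x → ΣF-cong λ y → ΣF-cong λ z → pull₃ [ P? x ] [ Q? y ] [ R? z ]) ⟩
    (ΣF λ x → ΣF λ y → ΣF λ z → [ P? x ] * ([ Q? y ] * ([ R? z ] * countF S?)))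
      ≡⟨ ΣF-cong (λ x → ΣF-cong λ y → pull₂ [ P? x ] [ Q? y ]) ⟩
    (ΣF λ x → ΣF λ y → [ P? x ] * ([ Q? y ] * (countF R? * countF S?)))
      ≡⟨ ΣF-cong (λ x → pull₁ [ P? x ]) ⟩
    (ΣF λ x → [ P? x ] * (countF Q? * (countF R? * countF S?)))
      ≡⟨ ΣF-*ʳ _ (λ x → [ P? x ]) ⟩
    countF P? * (countF Q? * (countF R? * countF S?))
      ∎
    where
    open ≡.≡-Reasoning
    [_] : ∀ {a} {A : Set a} → Dec A → ℕ
    [ A? ] = when A? 1
    when-×-* : ∀ {a b} {A : Set a} {B : Set b} (A? : Dec A) (B? : Dec B) → [ A? ×-dec B? ] ≡ [ A? ] * [ B? ]
    when-×-* A? B? = ≡.trans (when-× A? B? 1) (when-* A? [ B? ])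
    pull₃ : ∀ a b c → ΣF (λ w → a * (b * (c * [ S? w ]))) ≡ a * (b * (c * countF S?))
    pull₃ a b c = ≡.trans (ΣF-*ˡ a (λ w → b * (c * [ S? w ])))
                 (≡.cong (a *_) (≡.trans (ΣF-*ˡ b (λ w → c * [ S? w ])) (≡.cong (b *_) (ΣF-*ˡ c (λ w → [ S? w ])))))
    pull₂ : ∀ a b → ΣF (λ z → a * (b * ([ R? z ] * countF S?))) ≡ a * (b * (countF R? * countF S?))
    pull₂ a b = ≡.trans (ΣF-*ˡ a (λ z → b * ([ R? z ] * countF S?)))
                 (≡.cong (a *_) (≡.trans (ΣF-*ˡ b (λ z → [ R? z ] * countF S?)) (≡.cong (b *_) (ΣF-*ʳ _ (λ z → [ R? z ])))))
    pull₁ : ∀ a → ΣF (λ y → a * ([ Q? y ] * (countF R? * countF S?))) ≡ a * (countF Q? * (countF R? * countF S?))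
    pull₁ a = ≡.trans (ΣF-*ˡ a (λ y → [ Q? y ] * (countF R? * countF S?))) (≡.cong (a *_) (ΣF-*ʳ _ (λ y → [ Q? y ])))
    factorise : ∀ x y z w → [ V? (x , y , z , w) ] ≡ [ P? x ] * ([ Q? y ] * ([ R? z ] * [ S? w ]))
    factorise x y z w = begin
      [ V? (x , y , z , w) ]                                  ≡⟨ when-⇔ V⇔ (V? _) (P? x ×-dec Q? y ×-dec R? z ×-dec S? w) 1 ⟩
      [ P? x ×-dec Q? y ×-dec R? z ×-dec S? w ]               ≡⟨ when-×-* (P? x) _ ⟩
      [ P? x ] * [ Q? y ×-dec R? z ×-dec S? w ]               ≡⟨ ≡.cong ([ P? x ] *_) (when-×-* (Q? y) _) ⟩
      [ P? x ] * ([ Q? y ] * [ R? z ×-dec S? w ])             ≡⟨ ≡.cong (λ t → [ P? x ] * ([ Q? y ] * t)) (when-×-* (R? z) (S? w)) ⟩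
      [ P? x ] * ([ Q? y ] * ([ R? z ] * [ S? w ]))           ∎

  countM-≈ : ∀ B → countM (_≟M B) ≡ 1
  countM-≈ (a , b , c′ , d) =
    ≡.trans (countM-box (_≟M (a , b , c′ , d)) (_≟F a) (_≟F b) (_≟F c′) (_≟F d) (mk⇔ id id))
            (≡.cong₂ _*_ (countF-≈ a) (≡.cong₂ _*_ (countF-≈ b) (≡.cong₂ _*_ (countF-≈ c′) (countF-≈ d))))

  ΣM-point : ∀ B (g : Mat → ℕ) → (∀ {u v} → u ≈M v → g u ≡ g v) → ΣM (λ u → when (u ≟M B) (g u)) ≡ g B
  ΣM-point B g g-resp = begin
    ΣM (λ u → when (u ≟M B) (g u))       ≡⟨ sumℕ-cong allMat pointwise ⟩
    ΣM (λ u → when (u ≟M B) 1 * g B)     ≡⟨ sumℕ-*ʳ allMat (g B) (λ u → when (u ≟M B) 1) ⟩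
    countM (_≟M B) * g B                 ≡⟨ ≡.cong (_* g B) (countM-≈ B) ⟩
    1 * g B                              ≡⟨ *-identityˡ (g B) ⟩
    g B                                  ∎
    where
    open ≡.≡-Reasoning
    pointwise : ∀ u → when (u ≟M B) (g u) ≡ when (u ≟M B) 1 * g B
    pointwise u with u ≟M B
    ... | yes u≈B = ≡.trans (g-resp u≈B) (≡.sym (*-identityˡ (g B)))
    ... | no _    = ≡.refl

  ΣM-reindex : (ψ : Inverse ≈M-setoid ≈M-setoid) (f : Mat → ℕ) → (∀ {u v} → u ≈M v → f u ≡ f v) →
                 ΣM (f ∘ Inverse.to ψ) ≡ ΣM f
  ΣM-reindex ψ f f-resp = begin
    ΣM (λ u → f (to u))                              ≡⟨ sumℕ-cong allMat (λ u → ΣM-point (to u) f f-resp) ⟨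
    ΣM (λ u → ΣM (λ v → when (v ≟M to u) (f v)))    ≡⟨ sumℕ-swap allMat allMat (λ u v → when (v ≟M to u) (f v)) ⟩
    ΣM (λ v → ΣM (λ u → when (v ≟M to u) (f v)))    ≡⟨ sumℕ-cong allMat (λ v → sumℕ-cong allMat (λ u → when-⇔ (≈to⇔ u v) (v ≟M to u) (u ≟M from v) (f v))) ⟩
    ΣM (λ v → ΣM (λ u → when (u ≟M from v) (f v)))  ≡⟨ sumℕ-cong allMat (λ v → ΣM-point (from v) (λ _ → f v) (λ _ → ≡.refl)) ⟩
    ΣM f                                             ∎
    where
    open ≡.≡-Reasoning
    open Inverse ψ
    ≈to⇔ : ∀ u v → v ≈M to u ⇔ u ≈M from v
    ≈to⇔ u v = mk⇔ (λ v≈ → ≈M-sym (inverseʳ v≈)) (λ u≈ → ≈M-sym (inverseˡ u≈))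

  ΣF-twoValued : ∀ e (f : Carrier → ℕ) k₀ k₁ → (∀ x → x ≈ e → f x ≡ k₀) → (∀ x → ¬ x ≈ e → f x ≡ k₁) →
             ΣF f + k₁ ≡ k₀ + n * k₁
  ΣF-twoValued e f k₀ k₁ at-e off-e = begin
    ΣF f + k₁                                           ≡⟨ ≡.cong (ΣF f +_) (ΣF-point e k₁) ⟨
    ΣF f + ΣF (λ x → when (x ≟F e) k₁)                  ≡⟨ ΣF-+ f (λ x → when (x ≟F e) k₁) ⟨
    ΣF (λ x → f x + when (x ≟F e) k₁)                   ≡⟨ ΣF-cong pointwise ⟩
    ΣF (λ x → when (x ≟F e) k₀ + k₁)                    ≡⟨ ΣF-+ (λ x → when (x ≟F e) k₀) (λ _ → k₁) ⟩
    ΣF (λ x → when (x ≟F e) k₀) + ΣF (λ _ → k₁)         ≡⟨ ≡.cong₂ _+_ (ΣF-point e k₀) (ΣF-const k₁) ⟩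
    k₀ + n * k₁                                         ∎
    where
    open ≡.≡-Reasoning
    pointwise : ∀ x → f x + when (x ≟F e) k₁ ≡ when (x ≟F e) k₀ + k₁
    pointwise x with x ≟F e
    ... | yes x≈e = ≡.cong (_+ k₁) (at-e x x≈e)
    ... | no x≉e  = ≡.trans (+-identityʳ (f x)) (off-e x x≉e)

  -- The count is n [k ≈ 0] + n - 1; adding 1 avoids truncated subtraction.
  count-xy≈k : ∀ k → ΣF (λ b → countF (λ c → (b F.* c) ≟F k)) + 1 ≡ n * when (k ≟F 0#) 1 + n * 1
  count-xy≈k k = ΣF-twoValued 0# (λ b → countF (λ c → (b F.* c) ≟F k)) _ 1 at-0 off-0
    where
    at-0 : ∀ b → b ≈ 0# → countF (λ c → (b F.* c) ≟F k) ≡ n * when (k ≟F 0#) 1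
    at-0 b b≈0 = ≡.trans (ΣF-cong (λ c → when-⇔ (bc≈k⇔ c) ((b F.* c) ≟F k) (k ≟F 0#) 1)) (ΣF-const _)
      where
      bc≈k⇔ : ∀ c → (b F.* c) ≈ k ⇔ k ≈ 0#
      bc≈k⇔ c = mk⇔ (λ bc≈k → F.trans (F.sym bc≈k) (x≈0⇒x*y≈0 c b≈0)) (λ k≈0 → F.trans (x≈0⇒x*y≈0 c b≈0) (F.sym k≈0))
    off-0 : ∀ b → ¬ b ≈ 0# → countF (λ c → (b F.* c) ≟F k) ≡ 1
    off-0 b b≉0 =
      let b⁻¹ , bb⁻¹≈1 = F.inverse b b≉0
      in ≡.trans (ΣF-cong (λ c → when-⇔ (x*y≈k⇔y≈x⁻¹*k bb⁻¹≈1) ((b F.* c) ≟F k) (c ≟F (b⁻¹ F.* k)) 1))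
                 (countF-≈ (b⁻¹ F.* k))

  countF-x[1-x]≈0 : countF (λ a → (a F.* (1# F.- a)) ≟F 0#) ≡ 2
  countF-x[1-x]≈0 = begin
    countF (λ a → (a F.* (1# F.- a)) ≟F 0#)   ≡⟨ ΣF-cong pointwise ⟩
    ΣF (λ a → when (a ≟F 0#) 1 + when (a ≟F 1#) 1)   ≡⟨ ΣF-+ (λ a → when (a ≟F 0#) 1) (λ a → when (a ≟F 1#) 1) ⟩
    countF (_≟F 0#) + countF (_≟F 1#)        ≡⟨ ≡.cong₂ _+_ (countF-≈ 0#) (countF-≈ 1#) ⟩
    2                                         ∎
    where
    open ≡.≡-Reasoning
    root⇔ : ∀ {a} → (a F.* (1# F.- a)) ≈ 0# ⇔ (a ≈ 0# ⊎ a ≈ 1#)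
    root⇔ = x[1-x]≈0⇔x≈0⊎x≈1 _≟F_
    pointwise : ∀ a → when ((a F.* (1# F.- a)) ≟F 0#) 1 ≡ when (a ≟F 0#) 1 + when (a ≟F 1#) 1
    pointwise a with a ≟F 0# | a ≟F 1#
    ... | yes a≈0 | yes a≈1 = ⊥-elim (F.0≉1 (F.trans (F.sym a≈0) a≈1))
    ... | yes a≈0 | no _    = when-yes (Equivalence.from root⇔ (inj₁ a≈0)) (_ ≟F 0#) 1
    ... | no _    | yes a≈1 = when-yes (Equivalence.from root⇔ (inj₂ a≈1)) (_ ≟F 0#) 1
    ... | no a≉0  | no a≉1  = when-no (λ r → [ a≉0 , a≉1 ]′ (Equivalence.to root⇔ r)) (_ ≟F 0#) 1

  countM-nontrivIdem : countM isNontrivIdem? ≡ n * n + n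
  countM-nontrivIdem = +-cancelʳ-≡ n _ _ (begin
    countM isNontrivIdem? + n                              ≡⟨ ≡.cong₂ _+_ (ΣM≡ΣF⁴ _) (≡.trans (≡.sym (*-identityʳ n)) (≡.sym (ΣF-const 1))) ⟩
    ΣF (λ a → ΣF (λ b → ΣF (λ c → ΣF (λ d → when (isNontrivIdem? (a , b , c , d)) 1)))) + ΣF (λ _ → 1)
                                                          ≡⟨ ≡.cong (_+ ΣF (λ _ → 1)) (ΣF-cong λ a → ΣF-cong λ b → ΣF-cong λ c → fix-d a b c) ⟩
    ΣF (λ a → ΣF (λ b → countF (λ c → (b F.* c) ≟F k a))) + ΣF (λ _ → 1)
                                                          ≡⟨ ΣF-+ (λ a → ΣF (λ b → countF (λ c → (b F.* c) ≟F k a))) (λ _ → 1) ⟨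
    ΣF (λ a → ΣF (λ b → countF (λ c → (b F.* c) ≟F k a)) + 1)
                                                          ≡⟨ ΣF-cong (λ a → count-xy≈k (k a)) ⟩
    ΣF (λ a → n * when (k a ≟F 0#) 1 + n * 1)             ≡⟨ ΣF-+ (λ a → n * when (k a ≟F 0#) 1) (λ _ → n * 1) ⟩
    ΣF (λ a → n * when (k a ≟F 0#) 1) + ΣF (λ _ → n * 1)  ≡⟨ ≡.cong₂ _+_ (≡.trans (ΣF-*ˡ n (λ a → when (k a ≟F 0#) 1)) (≡.cong (n *_) countF-x[1-x]≈0)) (ΣF-const (n * 1)) ⟩
    n * 2 + n * (n * 1)                                   ≡⟨ arith n ⟩
    n * n + n + n                                         ∎)
    where
    open ≡.≡-Reasoning
    k : Carrier → Carrier
    k a = a F.* (1# F.- a)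
    fix-d : ∀ a b c → ΣF (λ d → when (isNontrivIdem? (a , b , c , d)) 1) ≡ when ((b F.* c) ≟F k a) 1
    fix-d a b c = ≡.trans
      (ΣF-cong λ d → ≡.trans (when-⇔ (nontrivIdem⇔ _≟F_) (isNontrivIdem? _) ((d ≟F (1# F.- a)) ×-dec ((b F.* c) ≟F k a)) 1)
                             (when-× (d ≟F (1# F.- a)) ((b F.* c) ≟F k a) 1))
      (ΣF-point (1# F.- a) _)
    arith : ∀ n → n * 2 + n * (n * 1) ≡ n * n + n + n
    arith = solve-∀

  countV : ∀ {q} {Q : Pred Mat q} → Decidable Q → ℕ
  countV Q? = ΣM (λ u → when (isNontrivIdem? u) (when (Q? u) 1))

  countV-box : ∀ {v p q r s} {V : Pred Mat v} {P : Pred Carrier p} {Q : Pred Carrier q} {R : Pred Carrier r} {S : Pred Carrier s}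
               (V? : Decidable V) (P? : Decidable P) (Q? : Decidable Q) (R? : Decidable R) (S? : Decidable S) →
               (∀ {x y z w} → (NontrivIdem (x , y , z , w) × V (x , y , z , w)) ⇔ (P x × Q y × R z × S w)) →
               countV V? ≡ countF P? * (countF Q? * (countF R? * countF S?))
  countV-box V? P? Q? R? S? V⇔ =
    ≡.trans (sumℕ-cong allMat (λ u → ≡.sym (when-× (isNontrivIdem? u) (V? u) 1)))
            (countM-box (λ u → isNontrivIdem? u ×-dec V? u) P? Q? R? S? V⇔)

  zeroProduct? : ∀ u v → Dec (ZeroProduct u v)
  zeroProduct? u v = ((u · v) ≟M O) ⊎-dec ((v · u) ≟M O)

  degree-E : countV (λ u → zeroProduct? u E) + 1 ≡ n + n
  degree-E = begin
    countV (λ u → zeroProduct? u E) + 1                              ≡⟨ ≡.cong (countV (λ u → zeroProduct? u E) +_) count-both ⟨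
    countV (λ u → zeroProduct? u E) + countV (λ u → uE? u ×-dec Eu? u) ≡⟨ sumℕ-+ allMat _ _ ⟨
    ΣM (λ u → when (isNontrivIdem? u) (when (uE? u ⊎-dec Eu? u) 1) + when (isNontrivIdem? u) (when (uE? u ×-dec Eu? u) 1))
                                                                     ≡⟨ sumℕ-cong allMat (λ u → inclusion-exclusion (isNontrivIdem? u) (uE? u) (Eu? u)) ⟩
    ΣM (λ u → when (isNontrivIdem? u) (when (uE? u) 1) + when (isNontrivIdem? u) (when (Eu? u) 1))
                                                                     ≡⟨ sumℕ-+ allMat _ _ ⟩
    countV uE? + countV Eu?                                          ≡⟨ ≡.cong₂ _+_ count-uE count-Eu ⟩
    n + n                                                            ∎
    where
    open ≡.≡-Reasoning
    uE? : ∀ u → Dec ((u · E) ≈M O)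
    uE? u = (u · E) ≟M O
    Eu? : ∀ u → Dec ((E · u) ≈M O)
    Eu? u = (E · u) ≟M O
    inclusion-exclusion : ∀ {p q r} {P : Set p} {Q : Set q} {R : Set r} (P? : Dec P) (Q? : Dec Q) (R? : Dec R) →
      when P? (when (Q? ⊎-dec R?) 1) + when P? (when (Q? ×-dec R?) 1) ≡ when P? (when Q? 1) + when P? (when R? 1)
    inclusion-exclusion (yes _) Q? R? = when-⊎-× Q? R?
    inclusion-exclusion (no _)  Q? R? = ≡.refl
    x≈0-box : ∀ {x y z w} → x ≈ 0# → NontrivIdem (x , y , z , w) ⇔ (w ≈ 1# × y F.* z ≈ 0#)
    x≈0-box = nontrivIdem-x≈0⇔ _≟F_
    count-uE : countV uE? ≡ n
    count-uE = ≡.trans (countV-box uE? (_≟F 0#) (λ _ → yes tt) (_≟F 0#) (_≟F 1#) (mk⇔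
        (λ (ni , uE≈O) → let x≈0 , z≈0 = Equivalence.to u·E≈O⇔ uE≈O
                         in x≈0 , tt , z≈0 , proj₁ (Equivalence.to (x≈0-box x≈0) ni))
        (λ (x≈0 , _ , z≈0 , w≈1) → Equivalence.from (x≈0-box x≈0) (w≈1 , y≈0⇒x*y≈0 _ z≈0) , Equivalence.from u·E≈O⇔ (x≈0 , z≈0))))
      (≡.trans (≡.cong₂ _*_ (countF-≈ 0#) (≡.cong₂ _*_ countF-all (≡.cong₂ _*_ (countF-≈ 0#) (countF-≈ 1#))))
               (≡.trans (*-identityˡ (n * 1)) (*-identityʳ n)))
    count-Eu : countV Eu? ≡ n
    count-Eu = ≡.trans (countV-box Eu? (_≟F 0#) (_≟F 0#) (λ _ → yes tt) (_≟F 1#) (mk⇔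
        (λ (ni , Eu≈O) → let x≈0 , y≈0 = Equivalence.to E·u≈O⇔ Eu≈O
                         in x≈0 , y≈0 , tt , proj₁ (Equivalence.to (x≈0-box x≈0) ni))
        (λ (x≈0 , y≈0 , _ , w≈1) → Equivalence.from (x≈0-box x≈0) (w≈1 , x≈0⇒x*y≈0 _ y≈0) , Equivalence.from E·u≈O⇔ (x≈0 , y≈0))))
      (≡.trans (≡.cong₂ _*_ (countF-≈ 0#) (≡.cong₂ _*_ (countF-≈ 0#) (≡.cong₂ _*_ countF-all (countF-≈ 1#))))
               (≡.trans (*-identityˡ (1 * (n * 1))) (≡.trans (*-identityˡ (n * 1)) (*-identityʳ n))))
    count-both : countV (λ u → uE? u ×-dec Eu? u) ≡ 1
    count-both = ≡.trans (countV-box (λ u → uE? u ×-dec Eu? u) (_≟F 0#) (_≟F 0#) (_≟F 0#) (_≟F 1#) (mk⇔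
        (λ (ni , uE≈O , Eu≈O) → let x≈0 , z≈0 = Equivalence.to u·E≈O⇔ uE≈O
                                in x≈0 , proj₂ (Equivalence.to E·u≈O⇔ Eu≈O) , z≈0 , proj₁ (Equivalence.to (x≈0-box x≈0) ni))
        (λ (x≈0 , y≈0 , z≈0 , w≈1) → Equivalence.from (x≈0-box x≈0) (w≈1 , x≈0⇒x*y≈0 _ y≈0) ,
                                     Equivalence.from u·E≈O⇔ (x≈0 , z≈0) , Equivalence.from E·u≈O⇔ (x≈0 , y≈0))))
      (≡.cong₂ _*_ (countF-≈ 0#) (≡.cong₂ _*_ (countF-≈ 0#) (≡.cong₂ _*_ (countF-≈ 0#) (countF-≈ 1#))))

  -- distSum and recipSum select their summands with a function local to Defs,
  -- which cannot be named here: the left-hand sides of the pointwise lemmas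
  -- for them are found by unification.
  mutual
    distSum≡ΣM : ∀ d → distSum d ≡ ΣM (λ u → when (isNontrivIdem? u) (d u))
    distSum≡ΣM d = sumℕ-cong allMat (distSum-summand d)

    distSum-summand : ∀ d u → _ ≡ when (isNontrivIdem? u) (d u)
    distSum-summand d u with isNontrivIdem? u
    ... | yes _ = ≡.refl
    ... | no _  = ≡.refl

  module Distances {A : Mat} (nA : NontrivIdem A) where
    open SimilarToE _≟F_ (nontrivIdem⇒similar-E _≟F_ nA)

    distance : Mat → ℕ
    distance u with u ≟M A | zeroProduct? u A
    ... | yes _ | _     = 0
    ... | no _  | yes _ = 1
    ... | no _  | no _  = 2

    distance-isDist : ∀ u → NontrivIdem u → IsDist u A (distance u)
    distance-isDist u nu with u ≟M A | zeroProduct? u A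
    ... | yes u≈A | _      = isDist-0 nu u≈A
    ... | no _    | yes uA = isDist-1 (zeroProduct⇒adj nu nA uA)
    ... | no u≉A  | no ¬uA =
      let C , uC , CA = commonNeighbour nu ¬uA
      in isDist-2 uC CA (λ (_ , _ , _ , uA) → ¬uA uA) u≉A

    degree : countV (λ u → zeroProduct? u A) + 1 ≡ n + n
    degree = ≡.trans (≡.cong (_+ 1) (≡.trans (≡.sym (ΣM-reindex conj-inverse adjacentToA adjacentToA-resp))
                                             (sumℕ-cong allMat pullback)))
                     degree-E
      where
      adjacentToA : Mat → ℕ
      adjacentToA u = when (isNontrivIdem? u) (when (zeroProduct? u A) 1)
      adjacentToA-resp : ∀ {u v} → u ≈M v → adjacentToA u ≡ adjacentToA v
      adjacentToA-resp u≈v = ≡.trans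
        (when-⇔ (nontrivIdem-cong u≈v) (isNontrivIdem? _) (isNontrivIdem? _) _)
        (≡.cong (when (isNontrivIdem? _)) (when-⇔ (mk⇔ (zeroProduct-resp u≈v ≈M-refl) (zeroProduct-resp (≈M-sym u≈v) ≈M-refl))
                                                  (zeroProduct? _ A) (zeroProduct? _ A) 1))
      pullback : ∀ u → adjacentToA (conj u) ≡ when (isNontrivIdem? u) (when (zeroProduct? u E) 1)
      pullback u = ≡.trans
        (when-⇔ conj-nontrivIdem⇔ (isNontrivIdem? (conj u)) (isNontrivIdem? u) _)
        (≡.cong (when (isNontrivIdem? u)) (when-⇔ zeroProduct-conj⇔ (zeroProduct? (conj u) A) (zeroProduct? u E) 1))

    countV-≈A : countV (_≟M A) ≡ 1
    countV-≈A = begin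
      ΣM (λ u → when (isNontrivIdem? u) (when (u ≟M A) 1))   ≡⟨ sumℕ-cong allMat (λ u → when-comm (isNontrivIdem? u) (u ≟M A) 1) ⟩
      ΣM (λ u → when (u ≟M A) (when (isNontrivIdem? u) 1))   ≡⟨ ΣM-point A (λ u → when (isNontrivIdem? u) 1) indicator-resp ⟩
      when (isNontrivIdem? A) 1                              ≡⟨ when-yes nA (isNontrivIdem? A) 1 ⟩
      1                                                      ∎
      where
      open ≡.≡-Reasoning
      indicator-resp : ∀ {u v} → u ≈M v → when (isNontrivIdem? u) 1 ≡ when (isNontrivIdem? v) 1
      indicator-resp u≈v = when-⇔ (nontrivIdem-cong u≈v) (isNontrivIdem? _) (isNontrivIdem? _) 1

    private
      distance-balance : ∀ u → when (isNontrivIdem? u) (distance u) + when (isNontrivIdem? u) (when (zeroProduct? u A) 1) + 2 * when (isNontrivIdem? u) (when (u ≟M A) 1)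
                               ≡ 2 * when (isNontrivIdem? u) 1
      distance-balance u with isNontrivIdem? u | u ≟M A | zeroProduct? u A
      ... | no _  | _       | _      = ≡.refl
      ... | yes _ | yes u≈A | yes uA = ⊥-elim (zeroProduct⇒≉ nA uA u≈A)
      ... | yes _ | yes _   | no _   = ≡.refl
      ... | yes _ | no _    | yes _  = ≡.refl
      ... | yes _ | no _    | no _   = ≡.refl

      twiceRecipDistance : Mat → ℕ
      twiceRecipDistance u with u ≟M A | zeroProduct? u A
      ... | yes _ | _     = 0
      ... | no _  | yes _ = 2
      ... | no _  | no _  = 1

      twiceRecipDistance-balance : ∀ u → when (isNontrivIdem? u) (twiceRecipDistance u) + when (isNontrivIdem? u) (when (u ≟M A) 1)
                                         ≡ when (isNontrivIdem? u) 1 + when (isNontrivIdem? u) (when (zeroProduct? u A) 1)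
      twiceRecipDistance-balance u with isNontrivIdem? u | u ≟M A | zeroProduct? u A
      ... | no _  | _       | _      = ≡.refl
      ... | yes _ | yes u≈A | yes uA = ⊥-elim (zeroProduct⇒≉ nA uA u≈A)
      ... | yes _ | yes _   | no _   = ≡.refl
      ... | yes _ | no _    | yes _  = ≡.refl
      ... | yes _ | no _    | no _   = ≡.refl

    mutual
      recipSum-twiceRecipDistance : recipSum A distance ≡ sumℚ allMat (λ u → half (when (isNontrivIdem? u) (twiceRecipDistance u)))
      recipSum-twiceRecipDistance = foldr-cong recipSum-step ≡.refl allMat

      recipSum-step : ∀ u q → _ ≡ half (when (isNontrivIdem? u) (twiceRecipDistance u)) ℚ.+ q
      recipSum-step u q with isNontrivIdem? u | u ≟M A | zeroProduct? u A
      ... | no _  | _     | _     = ≡.refl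
      ... | yes _ | yes _ | _     = ≡.refl
      ... | yes _ | no _  | yes _ = ≡.refl
      ... | yes _ | no _  | no _  = ≡.refl

    distSum-value : distSum distance ≡ 2 * (n * n) ∸ 1
    distSum-value = ≡.trans (distSum≡ΣM distance) (≡.trans (≡.sym (m+n∸n≡m D 1)) (≡.cong (_∸ 1) D+1≡2n²))
      where
      open ≡.≡-Reasoning
      D deg : ℕ
      D = ΣM (λ u → when (isNontrivIdem? u) (distance u))
      deg = countV (λ u → zeroProduct? u A)
      total : D + deg + 2 * 1 ≡ 2 * (n * n + n)
      total = begin
        D + deg + 2 * 1                 ≡⟨ ≡.cong (λ t → D + deg + 2 * t) countV-≈A ⟨
        D + deg + 2 * countV (_≟M A)    ≡⟨ ≡.cong₂ _+_ (sumℕ-+ allMat _ _) (sumℕ-*ˡ allMat 2 _) ⟨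
        ΣM (λ u → when (isNontrivIdem? u) (distance u) + when (isNontrivIdem? u) (when (zeroProduct? u A) 1)) + ΣM (λ u → 2 * when (isNontrivIdem? u) (when (u ≟M A) 1))
                                        ≡⟨ sumℕ-+ allMat _ _ ⟨
        ΣM (λ u → when (isNontrivIdem? u) (distance u) + when (isNontrivIdem? u) (when (zeroProduct? u A) 1) + 2 * when (isNontrivIdem? u) (when (u ≟M A) 1))
                                        ≡⟨ sumℕ-cong allMat distance-balance ⟩
        ΣM (λ u → 2 * when (isNontrivIdem? u) 1)   ≡⟨ sumℕ-*ˡ allMat 2 _ ⟩
        2 * countM isNontrivIdem?                  ≡⟨ ≡.cong (2 *_) countM-nontrivIdem ⟩
        2 * (n * n + n)                 ∎
      D+1≡2n² : D + 1 ≡ 2 * (n * n)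
      D+1≡2n² = +-cancelʳ-≡ (deg + 1) _ _ (begin
        D + 1 + (deg + 1)               ≡⟨ regroup D deg ⟩
        D + deg + 2 * 1                 ≡⟨ total ⟩
        2 * (n * n + n)                 ≡⟨ expand n ⟩
        2 * (n * n) + (n + n)           ≡⟨ ≡.cong (2 * (n * n) +_) degree ⟨
        2 * (n * n) + (deg + 1)         ∎)
        where
        regroup : ∀ a b → a + 1 + (b + 1) ≡ a + b + 2 * 1
        regroup = solve-∀
        expand : ∀ n → 2 * (n * n + n) ≡ 2 * (n * n) + (n + n)
        expand = solve-∀

    recipSum-value : recipSum A distance ≡ half (n * n + 3 * n ∸ 2)
    recipSum-value = ≡.trans recipSum-twiceRecipDistance (≡.trans (sumℚ-half allMat _)
                       (≡.cong half (≡.trans (≡.sym (m+n∸n≡m W 2)) (≡.cong (_∸ 2) W+2≡n²+3n))))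
      where
      open ≡.≡-Reasoning
      W deg : ℕ
      W = ΣM (λ u → when (isNontrivIdem? u) (twiceRecipDistance u))
      deg = countV (λ u → zeroProduct? u A)
      total : W + countV (_≟M A) ≡ countM isNontrivIdem? + deg
      total = begin
        W + countV (_≟M A)   ≡⟨ sumℕ-+ allMat _ _ ⟨
        ΣM (λ u → when (isNontrivIdem? u) (twiceRecipDistance u) + when (isNontrivIdem? u) (when (u ≟M A) 1))
                             ≡⟨ sumℕ-cong allMat twiceRecipDistance-balance ⟩
        ΣM (λ u → when (isNontrivIdem? u) 1 + when (isNontrivIdem? u) (when (zeroProduct? u A) 1))
                             ≡⟨ sumℕ-+ allMat _ _ ⟩
        countM isNontrivIdem? + deg ∎
      W+2≡n²+3n : W + 2 ≡ n * n + 3 * n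
      W+2≡n²+3n = begin
        W + 2                            ≡⟨ +-assoc W 1 1 ⟨
        W + 1 + 1                        ≡⟨ ≡.cong (λ t → W + t + 1) countV-≈A ⟨
        W + countV (_≟M A) + 1           ≡⟨ ≡.cong (_+ 1) total ⟩
        countM isNontrivIdem? + deg + 1  ≡⟨ +-assoc (countM isNontrivIdem?) deg 1 ⟩
        countM isNontrivIdem? + (deg + 1) ≡⟨ ≡.cong₂ _+_ countM-nontrivIdem degree ⟩
        n * n + n + (n + n)              ≡⟨ collect n ⟩
        n * n + 3 * n                    ∎
        where
        collect : ∀ n → n * n + n + (n + n) ≡ n * n + 3 * n
        collect = solve-∀

open import Level using (Level)
open import Data.Nat using (ℕ; _+_; _*_; _∸_)
open import Data.Integer using (+_)
open import Data.Rational using (_/_)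
open import Data.Product using (_×_; Σ-syntax; _,_)
open import Relation.Binary.PropositionalEquality using (_≡_)

corollary4p2 : ∀ {c ℓ : Level} (F : Field c ℓ) (n : ℕ) (card : HasCard F n)
    (A : M2.Mat F) → M2.NontrivIdem F A →
    Σ[ d ∈ (M2.Mat F → ℕ) ]
      ((∀ u → M2.NontrivIdem F u → M2.IsDist F u A (d u))
      × M2.Enum.distSum F card d ≡ 2 * (n * n) ∸ 1
      × M2.Enum.recipSum F card A d ≡ (+ (n * n + 3 * n ∸ 2)) / 2)
corollary4p2 F n card A nA = distance , distance-isDist , distSum-value , recipSum-value
  where open Counting.Distances F card nA
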